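{- For each $n \geq 0$, the family $\{\textsf{E}_\pi : \pi \in A_n\}$ is a basis of the graded component $\textsf{ParSym}_n = \operatorname{span}_{\mathbbm{k}}\{\textsf{H}_\pi : \pi \in A_n\}$.
   Context: Partition diagrams of order $k$ are set partitions of $\{1,\ldots,k,1',\ldots,k'\}$; $A_k$ is the set of them, $A_0=\{\varnothing\}$. For $\pi$ of order $k$, $\rho$ of order $l$: $\pi\otimes\rho$ has as blocks those of $\pi$ and those of $\rho$ shifted ($i\mapsto i+k$, $i'\mapsto(i+k)'$). A diagram is $\otimes$-irreducible if it is not $\rho^{(1)}\otimes\rho^{(2)}$ with both factors nonempty; every nonempty diagram factors uniquely as a $\otimes$-product of nonempty $\otimes$-irreducible diagrams. For nonempty $\pi,\rho$ (orders $k,l$), $\pi\bullet\rho$ is obtained from $\pi\otimes\rho$ by merging the block containing $k'$ with the block containing $(k+1)'$. Over a field $\mathbbm{k}$, $\textsf{ParSym}$ has basis $\{\textsf{H}_\pi : \pi\in A_i, i\geq0\}$ with product $\textsf{H}_\pi\textsf{H}_\rho=\textsf{H}_{\pi\otimes\rho}$ and unit $\textsf{H}_\varnothing$. For a nonempty $\otimes$-irreducible $\pi$ of order $n$, define $\textsf{E}_\pi=\sum(-1)^{\ell+n}\textsf{H}_{\rho^{(1)}}\cdots\textsf{H}_{\rho^{(\ell)}}$, summed over all tuples $(\rho^{(1)},\ldots,\rho^{(\ell)})$, $\ell\geq1$, of nonempty diagrams with $\rho^{(1)}\bullet\cdots\bullet\rho^{(\ell)}=\pi$; for nonempty $\otimes$-irreducible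 $\pi^{(1)},\ldots,\pi^{(p)}$ set $\textsf{E}_{\pi^{(1)}\otimes\cdots\otimes\pi^{(p)}}=\textsf{E}_{\pi^{(1)}}\cdots\textsf{E}_{\pi^{(p)}}$, and $\textsf{E}_\varnothing=\textsf{H}_\varnothing$. -}

module Defs where

open import Level using (_⊔_)
open import Data.Nat as ℕ using (ℕ; zero; suc; _+_; _∸_; _≡ᵇ_; ⌊_/2⌋)
open import Data.Bool using (Bool; true; false; if_then_else_)
open import Data.Maybe using (Maybe; just; nothing)
open import Data.Product using (_×_; _,_; proj₁; proj₂; ∃)
open import Data.List using (List; []; _∷_; [_]; _++_; map; concatMap; foldr; foldl; length; take; drop; upTo; applyUpTo)
open import Data.List.Relation.Unary.All using (All)
open import Data.List.Properties using (≡-dec)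
open import Relation.Binary.PropositionalEquality using (_≡_)
open import Relation.Nullary using (¬_; yes; no)
open import Algebra.Bundles using (CommutativeRing)

record Field (c ℓ : Level.Level) : Set (Level.suc (c ⊔ ℓ)) where
  field
    commutativeRing : CommutativeRing c ℓ
  open CommutativeRing commutativeRing public
  field
    1≉0     : ¬ (1# ≈ 0#)
    inverse : ∀ x → ¬ (x ≈ 0#) → ∃ λ y → x * y ≈ 1#

-- Set partitions of {0,…,m-1} encoded canonically as restricted growth
-- strings: a list of block labels, blocks numbered 0,1,2,… in order of
-- first appearance.  A partition diagram of order k is such a string of
-- length 2k; position i-1 (0 ≤ i-1 < k) stands for the vertex i, and
-- position k+i-1 for the vertex i'.

_==_ : ℕ → ℕ → Bool
_==_ = _≡ᵇ_

indexOf : ℕ → List ℕ → Maybe ℕ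
indexOf x []       = nothing
indexOf x (y ∷ ys) = if x == y then just 0 else go (indexOf x ys)
  where
  go : Maybe ℕ → Maybe ℕ
  go (just i) = just (suc i)
  go nothing  = nothing

normGo : List ℕ → List ℕ → List ℕ
normGo seen []       = []
normGo seen (x ∷ xs) with indexOf x seen
... | just i  = i ∷ normGo seen xs
... | nothing = length seen ∷ normGo (seen ++ [ x ]) xs

norm : List ℕ → List ℕ
norm = normGo []

IsDiagram : ℕ → List ℕ → Set
IsDiagram n σ = (length σ ≡ n + n) × (norm σ ≡ σ)

ord : List ℕ → ℕ
ord σ = ⌊ length σ /2⌋

_=L_ : List ℕ → List ℕ → Bool
σ =L τ with ≡-dec ℕ._≟_ σ τ
... | yes _ = true
... | no  _ = false

nth : List ℕ → ℕ → ℕ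
nth []       i       = 0
nth (x ∷ xs) zero    = x
nth (x ∷ xs) (suc i) = nth xs i

_⊗_ : List ℕ → List ℕ → List ℕ
π ⊗ ρ = norm (take k π ++ map sh (take l ρ) ++ drop k π ++ map sh (drop l ρ))
  where
  k = ord π
  l = ord ρ
  sh : ℕ → ℕ
  sh x = length π + x

-- π • ρ (for nonempty π, ρ): merge the blocks of k' and (k+1)' in π ⊗ ρ
_•_ : List ℕ → List ℕ → List ℕ
π • ρ = norm (map (λ x → if x == b then a else x) t)
  where
  k = ord π
  m = ord π + ord ρ
  t = π ⊗ ρ
  a = nth t (m + (k ∸ 1))   -- label of block containing k'
  b = nth t (m + k)         -- label of block containing (k+1)'

-- all restricted growth strings of length m, given b blocks used so far
gen : ℕ → ℕ → List (List ℕ)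
gen zero    b = [ [] ]
gen (suc m) b = concatMap (λ j → map (j ∷_) (gen m (if j == b then suc b else b))) (upTo (suc b))

diagrams : ℕ → List (List ℕ)
diagrams k = gen (k + k) 0

compositions : ℕ → List (List ℕ)
compositions zero    = [ [] ]
compositions (suc m) = map (1 ∷_) (compositions m) ++ concatMap inc (compositions m)
  where
  inc : List ℕ → List (List ℕ)
  inc []       = []
  inc (a ∷ as) = [ suc a ∷ as ]

choices : List ℕ → List (List (List ℕ))
choices []       = [ [] ]
choices (a ∷ as) = concatMap (λ ρ → map (ρ ∷_) (choices as)) (diagrams a)

tuples : ℕ → List (List (List ℕ))
tuples n = concatMap choices (compositions n)

bulletFold : List (List ℕ) → List ℕ
bulletFold []       = []
bulletFold (ρ ∷ ρs) = foldl _•_ ρ ρs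

firstSplit : List ℕ → Maybe (List ℕ × List ℕ)
firstSplit π = firstJust (concatMap
    (λ i → concatMap (λ ρ₁ → map (ρ₁ ,_) (diagrams (n ∸ i))) (diagrams i))
    (applyUpTo suc (n ∸ 1)))
  where
  n = ord π
  firstJust : List (List ℕ × List ℕ) → Maybe (List ℕ × List ℕ)
  firstJust []              = nothing
  firstJust ((ρ₁ , ρ₂) ∷ r) = if (ρ₁ ⊗ ρ₂) =L π then just (ρ₁ , ρ₂) else firstJust r

-- factorization into nonempty ⊗-irreducible diagrams (fuel = order)
factorsF : ℕ → List ℕ → List (List ℕ)
factorsF zero    π = []
factorsF (suc f) π with firstSplit π
... | nothing         = [ π ]
... | just (ρ₁ , ρ₂)  = ρ₁ ∷ factorsF f ρ₂

factors : List ℕ → List (List ℕ)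
factors π = factorsF (ord π) π

module ParSym {c ℓ} (K : Field c ℓ) where
  open Field K renaming (_+_ to _+K_; _*_ to _*K_)

  -- a formal linear combination  Σ cᵢ H_{πᵢ}
  PS : Set c
  PS = List (Carrier × List ℕ)

  coeff : PS → List ℕ → Carrier
  coeff v σ = foldr (λ t acc → if proj₂ t =L σ then proj₁ t +K acc else acc) 0# v

  _≈P_ : PS → PS → Set ℓ
  v ≈P w = ∀ σ → coeff v σ ≈ coeff w σ

  0P : PS
  0P = []

  H : List ℕ → PS
  H σ = [ (1# , σ) ]

  _+P_ : PS → PS → PS
  _+P_ = _++_

  scale : Carrier → PS → PS
  scale a = map (λ t → (a *K proj₁ t , proj₂ t))

  _*P_ : PS → PS → PS
  v *P w = concatMap (λ s → map (λ t → (proj₁ s *K proj₁ t , proj₂ s ⊗ proj₂ t)) w) v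

  sign : ℕ → Carrier
  sign zero    = 1#
  sign (suc m) = - (sign m)

  prodH : List (List ℕ) → PS
  prodH ρs = foldr (λ ρ acc → H ρ *P acc) (H []) ρs

  -- E_π for nonempty ⊗-irreducible π of order n
  Eirr : List ℕ → PS
  Eirr π = concatMap
    (λ ρs → if bulletFold ρs =L π then scale (sign (length ρs ℕ.+ n)) (prodH ρs) else [])
    (tuples n)
    where n = ord π

  E : List ℕ → PS
  E π = foldr (λ τ acc → Eirr τ *P acc) (H []) (factors π)

  combE : PS → PS
  combE cs = concatMap (λ t → scale (proj₁ t) (E (proj₂ t))) cs

  IsBasisE : ℕ → Set (c ⊔ ℓ)
  IsBasisE n =
    -- each E_π (π ∈ A_n) lies in ParSym_n
    (∀ π → IsDiagram n π → ∀ σ → ¬ IsDiagram n σ → coeff (E π) σ ≈ 0#)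
    × (∀ (v : PS) → All (λ t → IsDiagram n (proj₂ t)) v →
         ∃ λ (cs : PS) → All (λ t → IsDiagram n (proj₂ t)) cs × combE cs ≈P v)
    × (∀ (cs : PS) → All (λ t → IsDiagram n (proj₂ t)) cs →
         combE cs ≈P 0P → ∀ π → coeff cs π ≈ 0#)

-- Order partition diagrams by their coincidences, the number of pairs of vertices lying in a
-- common block.  The product ⊗ adds coincidences, while ρ • ρ′ merges two distinct blocks of
-- ρ ⊗ ρ′ and so has strictly more of them.  Hence, for ⊗-irreducible π of order n, E_π is ±H_π
-- plus a combination of H_σ with σ ∈ A_n having fewer coincidences than π, and products of such
-- expansions keep this shape.  The matrix expressing {E_π : π ∈ A_n} in {H_σ : σ ∈ A_n} is thus
-- unitriangular with diagonal ±1, so the E_π form a basis of ParSym_n.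

module Submission where

open import Defs
open import Algebra.Bundles using (CommutativeMonoid)
open import Data.Nat using (ℕ)
open import Data.List using (List)
open import Data.List.Membership.Propositional using (_∈_)
open import Data.List.Relation.Unary.All using (All)
open import Data.Product using (_×_; _,_; proj₁; proj₂)
open import Relation.Binary.Definitions using (DecidableEquality)
open import Relation.Binary.PropositionalEquality using (_≡_)
open import Relation.Unary using (Decidable)

module ListSum {c ℓ} (M : CommutativeMonoid c ℓ) where
  open import Data.List using ([]; _∷_)
  open import Data.List.Relation.Unary.Any using (here; there)
  import Relation.Binary.PropositionalEquality as ≡
  open CommutativeMonoid M
  open import Algebra.Properties.CommutativeSemigroup commutativeSemigroup using (interchange)
  open import Relation.Binary.Reasoning.Setoid setoid

  ∑ : ∀ {x} {X : Set x} → List X → (X → Carrier) → Carrier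
  ∑ [] f = ε
  ∑ (x ∷ xs) f = f x ∙ ∑ xs f

  module _ {x} {X : Set x} where

    ∑-cong : ∀ (xs : List X) {f g} → (∀ {x} → x ∈ xs → f x ≈ g x) → ∑ xs f ≈ ∑ xs g
    ∑-cong [] f≈g = refl
    ∑-cong (x ∷ xs) f≈g = ∙-cong (f≈g (here ≡.refl)) (∑-cong xs (λ x∈ → f≈g (there x∈)))

    ∑-vanishing : ∀ (xs : List X) {f} → (∀ {x} → x ∈ xs → f x ≈ ε) → ∑ xs f ≈ ε
    ∑-vanishing [] f≈ε = refl
    ∑-vanishing (x ∷ xs) f≈ε =
      trans (∙-cong (f≈ε (here ≡.refl)) (∑-vanishing xs (λ x∈ → f≈ε (there x∈)))) (identityˡ ε)

    ∑-distrib : ∀ (xs : List X) f g → ∑ xs (λ x → f x ∙ g x) ≈ ∑ xs f ∙ ∑ xs g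
    ∑-distrib [] f g = sym (identityˡ ε)
    ∑-distrib (x ∷ xs) f g = begin
      (f x ∙ g x) ∙ ∑ xs (λ x → f x ∙ g x) ≈⟨ ∙-congˡ (∑-distrib xs f g) ⟩
      (f x ∙ g x) ∙ (∑ xs f ∙ ∑ xs g)       ≈⟨ interchange (f x) (g x) (∑ xs f) (∑ xs g) ⟩
      (f x ∙ ∑ xs f) ∙ (g x ∙ ∑ xs g)       ∎

module Multiplicity {a} {A : Set a} (_≟A_ : DecidableEquality A) where
  open import Data.Nat using (suc; _+_)
  open import Data.Nat.Properties using (suc-injective; +-0-commutativeMonoid)
  open import Data.List using ([]; _∷_; _++_; length; filter; concatMap)
  open import Data.List.Properties using (length-++; filter-++; filter-accept; filter-reject; filter-none)
  open import Data.List.Membership.Propositional using (_∉_)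
  open import Data.List.Relation.Unary.Any using (here; there)
  import Data.List.Relation.Unary.All as All
  open import Data.List.Relation.Binary.Permutation.Propositional using (_↭_)
  open import Data.List.Relation.Binary.Permutation.Propositional.Properties using (↭-length; filter-↭)
  open import Relation.Nullary using (yes; no)
  import Relation.Binary.PropositionalEquality as ≡
  open ≡ using (_≢_; cong)

  count : A → List A → ℕ
  count x ys = length (filter (_≟A x) ys)

  count-++ : ∀ x ys zs → count x (ys ++ zs) ≡ count x ys + count x zs
  count-++ x ys zs = ≡.trans (cong length (filter-++ (_≟A x) ys zs)) (length-++ (filter (_≟A x) ys))

  count-≡-head : ∀ {x y} ys → y ≡ x → count x (y ∷ ys) ≡ suc (count x ys)
  count-≡-head ys y≡x = cong length (filter-accept (_≟A _) y≡x)

  count-≢-head : ∀ {x y} ys → y ≢ x → count x (y ∷ ys) ≡ count x ys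
  count-≢-head ys y≢x = cong length (filter-reject (_≟A _) y≢x)

  count-∉ : ∀ {x} ys → x ∉ ys → count x ys ≡ 0
  count-∉ ys x∉ = cong length (filter-none (_≟A _) (All.tabulate (λ y∈ y≡x → x∉ (≡.subst (_∈ ys) y≡x y∈))))

  count-↭ : ∀ x {ys zs} → ys ↭ zs → count x ys ≡ count x zs
  count-↭ x ys↭zs = ↭-length (filter-↭ (_≟A x) ys↭zs)

  count≡suc⇒∈ : ∀ {x} ys {k} → count x ys ≡ suc k → x ∈ ys
  count≡suc⇒∈ {x} (y ∷ ys) found with y ≟A x
  ... | yes y≡x = here (≡.sym y≡x)
  ... | no _ = there (count≡suc⇒∈ ys found)


  module _ {c ℓ} (M : CommutativeMonoid c ℓ) where
    open CommutativeMonoid M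
    open ListSum M

    ∑-concentrated-absent : ∀ (xs : List A) {f} y → count y xs ≡ 0 →
      (∀ {x} → x ∈ xs → x ≢ y → f x ≈ ε) → ∑ xs f ≈ ε
    ∑-concentrated-absent [] y none vanish = refl
    ∑-concentrated-absent (x ∷ xs) y none vanish with x ≟A y
    ... | no x≢y = trans (∙-cong (vanish (here ≡.refl) x≢y) (∑-concentrated-absent xs y none (λ x∈ → vanish (there x∈))))
                         (identityˡ ε)

    ∑-concentrated-once : ∀ (xs : List A) {f} y → count y xs ≡ 1 →
      (∀ {x} → x ∈ xs → x ≢ y → f x ≈ ε) → ∑ xs f ≈ f y
    ∑-concentrated-once (x ∷ xs) y once vanish with x ≟A y
    ... | yes ≡.refl = trans (∙-congˡ (∑-concentrated-absent xs y (suc-injective once) (λ x∈ → vanish (there x∈))))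
                             (identityʳ _)
    ... | no x≢y = trans (∙-cong (vanish (here ≡.refl) x≢y) (∑-concentrated-once xs y once (λ x∈ → vanish (there x∈))))
                         (identityˡ _)

  count-concatMap : ∀ {b} {B : Set b} y (F : B → List A) js →
    count y (concatMap F js) ≡ ListSum.∑ +-0-commutativeMonoid js (λ j → count y (F j))
  count-concatMap y F [] = ≡.refl
  count-concatMap y F (j ∷ js) = ≡.trans (count-++ y (F j) (concatMap F js)) (cong (count y (F j) +_) (count-concatMap y F js))

module Nth where
  open import Data.Nat using (zero; suc; _+_; _<_; s≤s)
  open import Data.List using ([]; _∷_; _++_; map; length)
  open import Data.List.Relation.Unary.Any using (here; there)
  open import Relation.Binary.PropositionalEquality using (refl)

  nth-map : ∀ g xs {i} → i < length xs → nth (map g xs) i ≡ g (nth xs i)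
  nth-map g (x ∷ xs) {zero} _ = refl
  nth-map g (x ∷ xs) {suc i} (s≤s i<) = nth-map g xs i<

  nth-∈ : ∀ xs {i} → i < length xs → nth xs i ∈ xs
  nth-∈ (x ∷ xs) {zero} _ = here refl
  nth-∈ (x ∷ xs) {suc i} (s≤s i<) = there (nth-∈ xs i<)

  nth-++ˡ : ∀ xs ys {i} → i < length xs → nth (xs ++ ys) i ≡ nth xs i
  nth-++ˡ (x ∷ xs) ys {zero} _ = refl
  nth-++ˡ (x ∷ xs) ys {suc i} (s≤s i<) = nth-++ˡ xs ys i<

  nth-++ʳ : ∀ xs ys i → nth (xs ++ ys) (length xs + i) ≡ nth ys i
  nth-++ʳ [] ys i = refl
  nth-++ʳ (x ∷ xs) ys i = nth-++ʳ xs ys i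

module Coincidences where
  open import Data.Nat
  open import Data.Nat.Properties
  open import Data.Nat.Solver using (module +-*-Solver)
  open +-*-Solver using (solve; _:+_; _:=_)
  open import Data.List using ([]; _∷_; _++_; map; length)
  open import Data.List.Relation.Unary.Any using (here; there)
  open import Data.List.Relation.Binary.Permutation.Propositional using (_↭_; refl; prep; swap; trans)
  open import Data.Empty using (⊥-elim)
  open import Relation.Nullary using (yes; no)
  import Relation.Binary.PropositionalEquality as ≡
  open ≡ using (_≢_; refl; sym; cong; cong₂; ≢-sym)
  open Multiplicity _≟_

  InjectiveOn : (ℕ → ℕ) → List ℕ → Set
  InjectiveOn g xs = ∀ {a b} → a ∈ xs → b ∈ xs → g a ≡ g b → a ≡ b

  coincidences : List ℕ → ℕ
  coincidences [] = 0
  coincidences (x ∷ xs) = count x xs + coincidences xs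

  coincidencesBetween : List ℕ → List ℕ → ℕ
  coincidencesBetween [] ys = 0
  coincidencesBetween (x ∷ xs) ys = count x ys + coincidencesBetween xs ys

  coincidences-++ : ∀ xs ys →
    coincidences (xs ++ ys) ≡ coincidences xs + coincidences ys + coincidencesBetween xs ys
  coincidences-++ [] ys = sym (+-identityʳ (coincidences ys))
  coincidences-++ (x ∷ xs) ys rewrite count-++ x xs ys | coincidences-++ xs ys =
    solve 5 (λ a b c d e → (a :+ b) :+ (c :+ d :+ e) := a :+ c :+ d :+ (b :+ e)) refl
      (count x xs) (count x ys) (coincidences xs) (coincidences ys) (coincidencesBetween xs ys)

  coincidences-↭ : ∀ {xs ys} → xs ↭ ys → coincidences xs ≡ coincidences ys
  coincidences-↭ refl = refl
  coincidences-↭ (prep x p) = cong₂ _+_ (count-↭ x p) (coincidences-↭ p)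
  coincidences-↭ (swap {xs} {ys} x y p) with y ≟ x
  ... | yes refl rewrite count-≡-head xs (refl {x = y}) | count-≡-head ys (refl {x = y})
                       | count-↭ y p | coincidences-↭ p = refl
  ... | no y≢x rewrite count-≢-head xs y≢x | count-≢-head ys (≢-sym y≢x)
                     | count-↭ x p | count-↭ y p | coincidences-↭ p =
    solve 3 (λ a b c → a :+ (b :+ c) := b :+ (a :+ c)) refl (count x ys) (count y ys) (coincidences ys)
  coincidences-↭ (trans p q) = ≡.trans (coincidences-↭ p) (coincidences-↭ q)

  coincidencesBetween-disjoint : ∀ xs ys → (∀ {x y} → x ∈ xs → y ∈ ys → x ≢ y) →
    coincidencesBetween xs ys ≡ 0
  coincidencesBetween-disjoint [] ys disjoint = refl
  coincidencesBetween-disjoint (x ∷ xs) ys disjoint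
    rewrite count-∉ ys (λ x∈ys → disjoint (here refl) x∈ys refl) =
    coincidencesBetween-disjoint xs ys (λ x∈ → disjoint (there x∈))

  coincidences-++-disjoint : ∀ xs ys → (∀ {x y} → x ∈ xs → y ∈ ys → x ≢ y) →
    coincidences (xs ++ ys) ≡ coincidences xs + coincidences ys
  coincidences-++-disjoint xs ys disjoint rewrite coincidences-++ xs ys | coincidencesBetween-disjoint xs ys disjoint =
    +-identityʳ _

  -- Since _≟_ on ℕ computes, `with` cannot expose the case split inside count;
  -- the count-≡-head and count-≢-head rewrites do it instead.
  count-map-injective : ∀ g x ys → (∀ {y} → y ∈ ys → g y ≡ g x → y ≡ x) →
    count (g x) (map g ys) ≡ count x ys
  count-map-injective g x [] inj = refl
  count-map-injective g x (y ∷ ys) inj with g y ≟ g x | y ≟ x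
  ... | yes gy≡gx | yes y≡x rewrite count-≡-head (map g ys) gy≡gx | count-≡-head ys y≡x =
    cong suc (count-map-injective g x ys (λ y∈ → inj (there y∈)))
  ... | no gy≢gx | no y≢x rewrite count-≢-head (map g ys) gy≢gx | count-≢-head ys y≢x =
    count-map-injective g x ys (λ y∈ → inj (there y∈))
  ... | yes gy≡gx | no y≢x = ⊥-elim (y≢x (inj (here refl) gy≡gx))
  ... | no gy≢gx | yes y≡x = ⊥-elim (gy≢gx (cong g y≡x))

  coincidences-map-injective : ∀ g xs → InjectiveOn g xs → coincidences (map g xs) ≡ coincidences xs
  coincidences-map-injective g [] inj = refl
  coincidences-map-injective g (x ∷ xs) inj =
    cong₂ _+_ (count-map-injective g x xs (λ y∈ → inj (there y∈) (here refl)))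
              (coincidences-map-injective g xs (λ a∈ b∈ → inj (there a∈) (there b∈)))

  count-map-≤ : ∀ f x ys → count x ys ≤ count (f x) (map f ys)
  count-map-≤ f x [] = z≤n
  count-map-≤ f x (y ∷ ys) with f y ≟ f x | y ≟ x
  ... | yes fy≡fx | yes y≡x rewrite count-≡-head (map f ys) fy≡fx | count-≡-head ys y≡x =
    s≤s (count-map-≤ f x ys)
  ... | yes fy≡fx | no y≢x rewrite count-≡-head (map f ys) fy≡fx | count-≢-head ys y≢x =
    m≤n⇒m≤1+n (count-map-≤ f x ys)
  ... | no fy≢fx | no y≢x rewrite count-≢-head (map f ys) fy≢fx | count-≢-head ys y≢x =
    count-map-≤ f x ys
  ... | no fy≢fx | yes y≡x = ⊥-elim (fy≢fx (cong f y≡x))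

  coincidences-map-≤ : ∀ f xs → coincidences xs ≤ coincidences (map f xs)
  coincidences-map-≤ f [] = z≤n
  coincidences-map-≤ f (x ∷ xs) = +-mono-≤ (count-map-≤ f x xs) (coincidences-map-≤ f xs)

  count-map-< : ∀ f x ys q → q < length ys → nth ys q ≢ x → f (nth ys q) ≡ f x →
    count x ys < count (f x) (map f ys)
  count-map-< f x (y ∷ ys) zero _ y≢x fy≡fx
    rewrite count-≡-head (map f ys) fy≡fx | count-≢-head ys y≢x = s≤s (count-map-≤ f x ys)
  count-map-< f x (y ∷ ys) (suc q) (s≤s q<) distinct merged with f y ≟ f x | y ≟ x
  ... | yes fy≡fx | yes y≡x rewrite count-≡-head (map f ys) fy≡fx | count-≡-head ys y≡x =
    s≤s (count-map-< f x ys q q< distinct merged)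
  ... | yes fy≡fx | no y≢x rewrite count-≡-head (map f ys) fy≡fx | count-≢-head ys y≢x =
    m<n⇒m<1+n (count-map-< f x ys q q< distinct merged)
  ... | no fy≢fx | no y≢x rewrite count-≢-head (map f ys) fy≢fx | count-≢-head ys y≢x =
    count-map-< f x ys q q< distinct merged
  ... | no fy≢fx | yes y≡x = ⊥-elim (fy≢fx (cong f y≡x))

  coincidences-map-< : ∀ f xs p q → p < q → q < length xs → nth xs q ≢ nth xs p →
    f (nth xs q) ≡ f (nth xs p) → coincidences xs < coincidences (map f xs)
  coincidences-map-< f (x ∷ xs) zero (suc q) _ (s≤s q<) distinct merged =
    +-mono-<-≤ (count-map-< f x xs q q< distinct merged) (coincidences-map-≤ f xs)
  coincidences-map-< f (x ∷ xs) (suc p) (suc q) (s≤s p<q) (s≤s q<) distinct merged =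
    +-mono-≤-< (count-map-≤ f x xs) (coincidences-map-< f xs p q p<q q< distinct merged)

module Relabelling where
  open import Data.Nat using (suc; _<_; _≟_)
  open import Data.Bool using (true; false)
  open import Data.Maybe as Maybe using (Maybe; just; nothing)
  open import Data.List using ([]; _∷_; [_]; _++_; map; length)
  open import Data.List.Properties using (++-assoc; ++-identityʳ; length-map; map-++)
  open import Data.List.Membership.Propositional.Properties using (∈-++⁻; ∈-++⁺ˡ; ∈-++⁺ʳ)
  open import Data.List.Relation.Unary.Any using (here; there)
  open import Data.Product using (∃)
  open import Data.Sum using (inj₁; inj₂)
  open import Data.Empty using (⊥-elim)
  open import Relation.Nullary using (yes; no)
  open import Relation.Nullary.Decidable using (dec-true; dec-false)
  open import Relation.Binary.PropositionalEquality using (_≢_; refl; sym; trans; cong; cong₂; subst; module ≡-Reasoning)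
  open Coincidences
  open Nth

  ==-≡ : ∀ {x y} → x ≡ y → (x == y) ≡ true
  ==-≡ = dec-true (_ ≟ _)

  ==-≢ : ∀ {x y} → x ≢ y → (x == y) ≡ false
  ==-≢ = dec-false (_ ≟ _)

  -- indexOf and normGo restated with _≟_, so that proofs can case-split on evidence.
  position : ℕ → List ℕ → Maybe ℕ
  position x [] = nothing
  position x (y ∷ ys) with x ≟ y
  ... | yes _ = just 0
  ... | no _  = Maybe.map suc (position x ys)

  indexOf≡position : ∀ x ys → indexOf x ys ≡ position x ys
  indexOf≡position x [] = refl
  indexOf≡position x (y ∷ ys) with x ≟ y
  ... | yes refl rewrite ==-≡ {x} refl = refl
  ... | no x≢y rewrite ==-≢ x≢y | indexOf≡position x ys with position x ys
  ...   | just _ = refl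
  ...   | nothing = refl

  position-++ : ∀ x S T {i} → position x S ≡ just i → position x (S ++ T) ≡ just i
  position-++ x (y ∷ S) T found with x ≟ y
  ... | yes _ = found
  ... | no _ with position x S in eq
  ...   | just _ rewrite position-++ x S T eq = found

  position-new : ∀ x S T → position x S ≡ nothing → position x (S ++ x ∷ T) ≡ just (length S)
  position-new x [] T _ with x ≟ x
  ... | yes _ = refl
  ... | no x≢x = ⊥-elim (x≢x refl)
  position-new x (y ∷ S) T absent with x ≟ y
  ... | no _ with position x S in eq
  ...   | nothing rewrite position-new x S T eq = refl

  position-nth : ∀ x S {i} → position x S ≡ just i → nth S i ≡ x
  position-nth x (y ∷ S) found with x ≟ y
  position-nth x (y ∷ S) refl | yes x≡y = sym x≡y
  ... | no _ with position x S in eq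
  position-nth x (y ∷ S) refl | no _ | just _ = position-nth x S eq

  position-∈ : ∀ x S → x ∈ S → ∃ λ i → position x S ≡ just i
  position-∈ x (y ∷ S) x∈ with x ≟ y
  ... | yes _ = 0 , refl
  position-∈ x (y ∷ S) (here x≡y) | no x≢y = ⊥-elim (x≢y x≡y)
  position-∈ x (y ∷ S) (there x∈) | no _ with position-∈ x S x∈
  ... | i , found rewrite found = suc i , refl

  position-just⇒∈ : ∀ x S {i} → position x S ≡ just i → x ∈ S
  position-just⇒∈ x (y ∷ S) found with x ≟ y
  ... | yes x≡y = here x≡y
  ... | no _ with position x S in eq
  ...   | just _ = there (position-just⇒∈ x S eq)

  position-map : ∀ g x S → (∀ {y} → y ∈ S → g x ≡ g y → x ≡ y) → position (g x) (map g S) ≡ position x S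
  position-map g x [] inj = refl
  position-map g x (y ∷ S) inj with g x ≟ g y | x ≟ y
  ... | yes _ | yes _ = refl
  ... | yes gx≡gy | no x≢y = ⊥-elim (x≢y (inj (here refl) gx≡gy))
  ... | no gx≢gy | yes x≡y = ⊥-elim (gx≢gy (cong g x≡y))
  ... | no _ | no _ = cong (Maybe.map suc) (position-map g x S (λ y∈ → inj (there y∈)))

  relabel : List ℕ → List ℕ → List ℕ
  relabel seen [] = []
  relabel seen (x ∷ xs) with position x seen
  ... | just i  = i ∷ relabel seen xs
  ... | nothing = length seen ∷ relabel (seen ++ [ x ]) xs

  normGo≡relabel : ∀ seen xs → normGo seen xs ≡ relabel seen xs
  normGo≡relabel seen [] = refl
  normGo≡relabel seen (x ∷ xs) rewrite indexOf≡position x seen with position x seen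
  ... | just i  = cong (i ∷_) (normGo≡relabel seen xs)
  ... | nothing = cong (length seen ∷_) (normGo≡relabel (seen ++ [ x ]) xs)

  seenAfter : List ℕ → List ℕ → List ℕ
  seenAfter seen [] = seen
  seenAfter seen (x ∷ xs) with position x seen
  ... | just _  = seenAfter seen xs
  ... | nothing = seenAfter (seen ++ [ x ]) xs

  seenAfter-extends : ∀ seen xs → ∃ λ T → seenAfter seen xs ≡ seen ++ T
  seenAfter-extends seen [] = [] , sym (++-identityʳ seen)
  seenAfter-extends seen (x ∷ xs) with position x seen
  ... | just _  = seenAfter-extends seen xs
  ... | nothing with seenAfter-extends (seen ++ [ x ]) xs
  ...   | T , eq = x ∷ T , trans eq (++-assoc seen [ x ] T)

  ∈-seenAfter-seen : ∀ seen xs {a} → a ∈ seen → a ∈ seenAfter seen xs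
  ∈-seenAfter-seen seen xs a∈ with seenAfter-extends seen xs
  ... | T , eq rewrite eq = ∈-++⁺ˡ a∈

  ∈-seenAfter : ∀ seen xs {a} → a ∈ xs → a ∈ seenAfter seen xs
  ∈-seenAfter seen (x ∷ xs) (here refl) with position x seen in eq
  ... | just i  = ∈-seenAfter-seen seen xs (position-just⇒∈ x seen eq)
  ... | nothing = ∈-seenAfter-seen (seen ++ [ x ]) xs (∈-++⁺ʳ seen (here refl))
  ∈-seenAfter seen (x ∷ xs) (there a∈) with position x seen
  ... | just _  = ∈-seenAfter seen xs a∈
  ... | nothing = ∈-seenAfter (seen ++ [ x ]) xs a∈

  labelIn : List ℕ → ℕ → ℕ
  labelIn F x = Maybe.fromMaybe 0 (position x F)

  labelIn-position : ∀ F x {i} → position x F ≡ just i → labelIn F x ≡ i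
  labelIn-position F x found rewrite found = refl

  labelIn-injective : ∀ F → InjectiveOn (labelIn F) F
  labelIn-injective F {a} {b} a∈ b∈ same with position-∈ a F a∈ | position-∈ b F b∈
  ... | i , fa | j , fb = begin
    a           ≡⟨ sym (position-nth a F fa) ⟩
    nth F i     ≡⟨ cong (nth F) (trans (sym (labelIn-position F a fa)) (trans same (labelIn-position F b fb))) ⟩
    nth F j     ≡⟨ position-nth b F fb ⟩
    b           ∎
    where open ≡-Reasoning

  relabel≡map : ∀ seen xs → relabel seen xs ≡ map (labelIn (seenAfter seen xs)) xs
  relabel≡map seen [] = refl
  relabel≡map seen (x ∷ xs) with position x seen in eq
  ... | just i with seenAfter-extends seen xs
  ...   | T , ext = cong₂ _∷_
    (sym (labelIn-position (seenAfter seen xs) x (subst (λ F → position x F ≡ just i) (sym ext) (position-++ x seen T eq))))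
    (relabel≡map seen xs)
  relabel≡map seen (x ∷ xs) | nothing with seenAfter-extends (seen ++ [ x ]) xs
  ...   | T , ext = cong₂ _∷_
    (sym (labelIn-position (seenAfter (seen ++ [ x ]) xs) x (subst (λ F → position x F ≡ just (length seen))
      (sym (trans ext (++-assoc seen [ x ] T))) (position-new x seen T eq))))
    (relabel≡map (seen ++ [ x ]) xs)

  relabel-map : ∀ g seen xs → InjectiveOn g (seen ++ xs) → relabel (map g seen) (map g xs) ≡ relabel seen xs
  relabel-map g seen [] inj = refl
  relabel-map g seen (x ∷ xs) inj
    rewrite position-map g x seen (λ y∈ → inj (∈-++⁺ʳ seen (here refl)) (∈-++⁺ˡ y∈))
    with position x seen
  ... | just i = cong (i ∷_) (relabel-map g seen xs (λ a∈ b∈ → inj (skip a∈) (skip b∈)))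
    where
    skip : ∀ {a} → a ∈ seen ++ xs → a ∈ seen ++ x ∷ xs
    skip a∈ with ∈-++⁻ seen a∈
    ... | inj₁ a∈seen = ∈-++⁺ˡ a∈seen
    ... | inj₂ a∈xs = ∈-++⁺ʳ seen (there a∈xs)
  ... | nothing rewrite sym (map-++ g seen [ x ]) | length-map g seen =
    cong (length seen ∷_) (relabel-map g (seen ++ [ x ]) xs (λ a∈ b∈ → inj (reassoc a∈) (reassoc b∈)))
    where
    reassoc : ∀ {a} → a ∈ (seen ++ [ x ]) ++ xs → a ∈ seen ++ x ∷ xs
    reassoc {a} = subst (a ∈_) (++-assoc seen [ x ] xs)

  normLabel : List ℕ → ℕ → ℕ
  normLabel z = labelIn (seenAfter [] z)

  norm≡map-normLabel : ∀ z → norm z ≡ map (normLabel z) z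
  norm≡map-normLabel z = trans (normGo≡relabel [] z) (relabel≡map [] z)

  normLabel-injective : ∀ z → InjectiveOn (normLabel z) z
  normLabel-injective z a∈ b∈ = labelIn-injective (seenAfter [] z) (∈-seenAfter [] z a∈) (∈-seenAfter [] z b∈)

  norm-map-injective : ∀ g z → InjectiveOn g z → norm (map g z) ≡ norm z
  norm-map-injective g z inj = trans (normGo≡relabel [] (map g z)) (trans (relabel-map g [] z inj) (sym (normGo≡relabel [] z)))

  norm-idempotent : ∀ z → norm (norm z) ≡ norm z
  norm-idempotent z =
    trans (cong norm (norm≡map-normLabel z)) (norm-map-injective (normLabel z) z (normLabel-injective z))

  length-norm : ∀ z → length (norm z) ≡ length z
  length-norm z rewrite norm≡map-normLabel z = length-map (normLabel z) z

  coincidences-norm : ∀ z → coincidences (norm z) ≡ coincidences z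
  coincidences-norm z rewrite norm≡map-normLabel z = coincidences-map-injective (normLabel z) z (normLabel-injective z)

  norm-reflects-nth-≡ : ∀ z {p q} → p < length z → q < length z → nth (norm z) p ≡ nth (norm z) q → nth z p ≡ nth z q
  norm-reflects-nth-≡ z p< q< same rewrite norm≡map-normLabel z =
    normLabel-injective z (nth-∈ z p<) (nth-∈ z q<) (trans (sym (nth-map _ z p<)) (trans same (nth-map _ z q<)))

module RestrictedGrowth where
  open import Data.Nat
  open import Data.Nat.Properties
  open import Data.Bool using (true; false; if_then_else_)
  open import Data.Maybe using (just; nothing)
  open import Data.List using ([]; _∷_; [_]; _++_; length; upTo)
  open import Data.List.Properties using (upTo-∷ʳ; length-upTo; ∷-injective; ∷-injectiveʳ)
  open import Data.List.Relation.Unary.All as All using ([]; _∷_)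
  open import Data.Sum using (_⊎_; inj₁; inj₂)
  open import Data.Empty using (⊥-elim)
  open import Relation.Nullary using (yes; no)
  open import Relation.Binary.PropositionalEquality using (_≢_; refl; sym; trans; cong; subst)
  open Relabelling

  blocksAfter : ℕ → ℕ → ℕ
  blocksAfter b j = if j == b then suc b else b

  data IsRGS : ℕ → List ℕ → Set where
    [] : ∀ {b} → IsRGS b []
    _∷_ : ∀ {b j σ} → j ≤ b → IsRGS (blocksAfter b j) σ → IsRGS b (j ∷ σ)

  blocksAfter-≤ : ∀ b j → blocksAfter b j ≤ suc b
  blocksAfter-≤ b j with j == b
  ... | true = ≤-refl
  ... | false = n≤1+n b

  blocksAfter-< : ∀ {b j} → j < b → blocksAfter b j ≡ b
  blocksAfter-< j<b rewrite ==-≢ (<⇒≢ j<b) = refl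

  blocksAfter-≡ : ∀ b → blocksAfter b b ≡ suc b
  blocksAfter-≡ b rewrite ==-≡ {b} refl = refl

  position-∷ʳ-absent : ∀ x S y → position x S ≡ nothing → x ≢ y → position x (S ++ [ y ]) ≡ nothing
  position-∷ʳ-absent x [] y _ x≢y with x ≟ y
  ... | yes x≡y = ⊥-elim (x≢y x≡y)
  ... | no _ = refl
  position-∷ʳ-absent x (z ∷ S) y absent x≢y with x ≟ z
  ... | no _ with position x S in eq
  ...   | nothing rewrite position-∷ʳ-absent x S y eq x≢y = refl

  position-upTo-< : ∀ {b x} → x < b → position x (upTo b) ≡ just x
  position-upTo-≥ : ∀ {b x} → b ≤ x → position x (upTo b) ≡ nothing
  position-upTo-< {suc b} {x} x<1+b =
    subst (λ L → position x L ≡ just x) (upTo-∷ʳ b) (last-or-earlier (m≤n⇒m<n∨m≡n (s≤s⁻¹ x<1+b)))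
    where
    last-or-earlier : x < b ⊎ x ≡ b → position x (upTo b ++ [ b ]) ≡ just x
    last-or-earlier (inj₁ x<b) = position-++ x (upTo b) [ b ] (position-upTo-< x<b)
    last-or-earlier (inj₂ refl) = subst (λ i → position x (upTo x ++ [ x ]) ≡ just i) (length-upTo x)
                                        (position-new x (upTo x) [] (position-upTo-≥ {x} ≤-refl))
  position-upTo-≥ {zero} _ = refl
  position-upTo-≥ {suc b} {x} 1+b≤x = subst (λ L → position x L ≡ nothing) (upTo-∷ʳ b)
    (position-∷ʳ-absent x (upTo b) b (position-upTo-≥ (<⇒≤ 1+b≤x)) (>⇒≢ 1+b≤x))

  relabel-upTo-IsRGS : ∀ {b σ} → IsRGS b σ → relabel (upTo b) σ ≡ σ
  relabel-upTo-IsRGS [] = refl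
  relabel-upTo-IsRGS {b} {j ∷ σ} (j≤b ∷ rgs) with m≤n⇒m<n∨m≡n j≤b
  ... | inj₁ j<b rewrite position-upTo-< j<b =
    cong (j ∷_) (relabel-upTo-IsRGS (subst (λ b → IsRGS b σ) (blocksAfter-< j<b) rgs))
  ... | inj₂ refl rewrite position-upTo-≥ (≤-refl {j}) | length-upTo j | upTo-∷ʳ j =
    cong (j ∷_) (relabel-upTo-IsRGS (subst (λ b → IsRGS b σ) (blocksAfter-≡ j) rgs))

  IsRGS-relabel-upTo : ∀ b σ → relabel (upTo b) σ ≡ σ → IsRGS b σ
  IsRGS-relabel-upTo b [] _ = []
  IsRGS-relabel-upTo b (j ∷ σ) fixed with j <? b
  ... | yes j<b rewrite position-upTo-< j<b =
    <⇒≤ j<b ∷ subst (λ b → IsRGS b σ) (sym (blocksAfter-< j<b)) (IsRGS-relabel-upTo b σ (∷-injectiveʳ fixed))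
  ... | no j≮b rewrite position-upTo-≥ (≮⇒≥ j≮b) | length-upTo b with ∷-injective fixed
  ...   | refl , fixed′ rewrite upTo-∷ʳ b =
    ≤-refl ∷ subst (λ b → IsRGS b σ) (sym (blocksAfter-≡ b)) (IsRGS-relabel-upTo (suc b) σ fixed′)

  IsRGS⇒normal : ∀ {σ} → IsRGS 0 σ → norm σ ≡ σ
  IsRGS⇒normal {σ} rgs = trans (normGo≡relabel [] σ) (relabel-upTo-IsRGS rgs)

  normal⇒IsRGS : ∀ {σ} → norm σ ≡ σ → IsRGS 0 σ
  normal⇒IsRGS {σ} normal = IsRGS-relabel-upTo 0 σ (trans (sym (normGo≡relabel [] σ)) normal)

  IsRGS-bounded : ∀ {b σ} → IsRGS b σ → All (_< b + length σ) σ
  IsRGS-bounded [] = []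
  IsRGS-bounded {b} {j ∷ σ} (j≤b ∷ rgs) =
    ≤-<-trans j≤b (m<m+n b z<s) ∷ All.map (λ x< → <-≤-trans x< bound) (IsRGS-bounded rgs)
    where
    bound : blocksAfter b j + length σ ≤ b + suc (length σ)
    bound = ≤-trans (+-monoˡ-≤ (length σ) (blocksAfter-≤ b j)) (≤-reflexive (sym (+-suc b (length σ))))

module DiagramOperations where
  open import Data.Nat
  open import Data.Nat.Properties
  open import Data.Nat.Solver using (module +-*-Solver)
  open +-*-Solver using (solve; _:+_; _:=_; con)
  open import Data.Bool using (true; false; if_then_else_)
  open import Data.List using ([]; _++_; map; length; take; drop)
  open import Data.List.Properties using (++-assoc; ++-identityʳ; length-map; map-++; length-++; length-take; length-drop; take++drop≡id)
  open import Data.List.Membership.Propositional.Properties using (∈-map⁻)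
  import Data.List.Relation.Unary.All as All
  import Data.List.Relation.Unary.All.Properties as All
  open import Data.List.Relation.Binary.Permutation.Propositional using (_↭_; module PermutationReasoning)
  open import Data.List.Relation.Binary.Permutation.Propositional.Properties using (++⁺ˡ; ++⁺ʳ; ++-comm; ↭-length)
  open import Data.Sum using (_⊎_; inj₁; inj₂)
  open import Relation.Binary.PropositionalEquality using (_≢_; refl; sym; trans; cong; cong₂; subst; subst₂; module ≡-Reasoning)
  open Coincidences
  open Nth
  open Relabelling
  open RestrictedGrowth

  ord-IsDiagram : ∀ {k σ} → IsDiagram k σ → ord σ ≡ k
  ord-IsDiagram {k} (len , _) rewrite len = sym (n≡⌊n+n/2⌋ k)

  IsDiagram-bounded : ∀ {k σ} → IsDiagram k σ → All (_< length σ) σ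
  IsDiagram-bounded (_ , normal) = IsRGS-bounded (normal⇒IsRGS normal)

  length-take-half : ∀ {k σ} → IsDiagram k σ → length (take k σ) ≡ k
  length-take-half {k} {σ} (len , _) rewrite length-take k σ | len = m≤n⇒m⊓n≡m (m≤m+n k k)

  length-drop-half : ∀ {k σ} → IsDiagram k σ → length (drop k σ) ≡ k
  length-drop-half {k} {σ} (len , _) rewrite length-drop k σ | len = m+n∸m≡n k k

  juxtaposition : ℕ → ℕ → List ℕ → List ℕ → List ℕ
  juxtaposition k l π ρ =
    take k π ++ map (length π +_) (take l ρ) ++ drop k π ++ map (length π +_) (drop l ρ)

  ⊗≡norm-juxtaposition : ∀ {k l π ρ} → IsDiagram k π → IsDiagram l ρ → π ⊗ ρ ≡ norm (juxtaposition k l π ρ)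
  ⊗≡norm-juxtaposition {k} {l} dπ dρ rewrite ord-IsDiagram {k} dπ | ord-IsDiagram {l} dρ = refl

  juxtaposition-↭ : ∀ k l π ρ → juxtaposition k l π ρ ↭ π ++ map (length π +_) ρ
  juxtaposition-↭ k l π ρ = begin
    A₁ ++ S₁ ++ A₂ ++ S₂
      ≡⟨ cong (A₁ ++_) (sym (++-assoc S₁ A₂ S₂)) ⟩
    A₁ ++ (S₁ ++ A₂) ++ S₂
      ↭⟨ ++⁺ˡ A₁ (++⁺ʳ S₂ (++-comm S₁ A₂)) ⟩
    A₁ ++ (A₂ ++ S₁) ++ S₂
      ≡⟨ cong (A₁ ++_) (++-assoc A₂ S₁ S₂) ⟩
    A₁ ++ A₂ ++ S₁ ++ S₂
      ≡⟨ sym (++-assoc A₁ A₂ (S₁ ++ S₂)) ⟩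
    (A₁ ++ A₂) ++ S₁ ++ S₂
      ≡⟨ cong₂ _++_ (take++drop≡id k π) (trans (sym (map-++ _ (take l ρ) (drop l ρ))) (cong (map _) (take++drop≡id l ρ))) ⟩
    π ++ map (length π +_) ρ ∎
    where
    open PermutationReasoning
    A₁ = take k π
    A₂ = drop k π
    S₁ = map (length π +_) (take l ρ)
    S₂ = map (length π +_) (drop l ρ)

  length-juxtaposition : ∀ {k l π ρ} → IsDiagram k π → IsDiagram l ρ →
    length (juxtaposition k l π ρ) ≡ (k + l) + (k + l)
  length-juxtaposition {k} {l} {π} {ρ} (lenπ , _) (lenρ , _) = begin
    length (juxtaposition k l π ρ)     ≡⟨ ↭-length (juxtaposition-↭ k l π ρ) ⟩
    length (π ++ map (length π +_) ρ)  ≡⟨ length-++ π ⟩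
    length π + length (map _ ρ)        ≡⟨ cong (length π +_) (length-map _ ρ) ⟩
    length π + length ρ                ≡⟨ cong₂ _+_ lenπ lenρ ⟩
    (k + k) + (l + l)                  ≡⟨ solve 2 (λ k l → (k :+ k) :+ (l :+ l) := (k :+ l) :+ (k :+ l)) refl k l ⟩
    (k + l) + (k + l)                  ∎
    where open ≡-Reasoning

  coincidences-juxtaposition : ∀ {k l π ρ} → IsDiagram k π →
    coincidences (juxtaposition k l π ρ) ≡ coincidences π + coincidences ρ
  coincidences-juxtaposition {k} {l} {π} {ρ} dπ = begin
    coincidences (juxtaposition k l π ρ)
      ≡⟨ coincidences-↭ (juxtaposition-↭ k l π ρ) ⟩
    coincidences (π ++ map (length π +_) ρ)
      ≡⟨ coincidences-++-disjoint π _ below-shifted ⟩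
    coincidences π + coincidences (map (length π +_) ρ)
      ≡⟨ cong (coincidences π +_) (coincidences-map-injective _ ρ (λ _ _ → +-cancelˡ-≡ (length π) _ _)) ⟩
    coincidences π + coincidences ρ ∎
    where
    open ≡-Reasoning
    below-shifted : ∀ {x y} → x ∈ π → y ∈ map (length π +_) ρ → x ≢ y
    below-shifted x∈ y∈ refl with ∈-map⁻ _ y∈
    ... | z , _ , refl = <⇒≱ (All.lookup (IsDiagram-bounded {k} dπ) x∈) (m≤m+n (length π) z)

  ⊗-IsDiagram : ∀ {k l π ρ} → IsDiagram k π → IsDiagram l ρ → IsDiagram (k + l) (π ⊗ ρ)
  ⊗-IsDiagram {k} {l} {π} {ρ} dπ dρ rewrite ⊗≡norm-juxtaposition {k} {l} dπ dρ =
    trans (length-norm (juxtaposition k l π ρ)) (length-juxtaposition {k} {l} dπ dρ) ,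
    norm-idempotent (juxtaposition k l π ρ)

  coincidences-⊗ : ∀ {k l π ρ} → IsDiagram k π → IsDiagram l ρ →
    coincidences (π ⊗ ρ) ≡ coincidences π + coincidences ρ
  coincidences-⊗ {k} {l} {π} {ρ} dπ dρ rewrite ⊗≡norm-juxtaposition {k} {l} dπ dρ =
    trans (coincidences-norm (juxtaposition k l π ρ)) (coincidences-juxtaposition {k} {l} dπ)

  ⊗-identityʳ : ∀ {k π} → IsDiagram k π → π ⊗ [] ≡ π
  ⊗-identityʳ {k} {π} dπ@(_ , normal) rewrite ord-IsDiagram {k} dπ | ++-identityʳ (drop k π) | take++drop≡id k π = normal

  merge : ℕ → ℕ → ℕ → ℕ
  merge a b x = if x == b then a else x

  merge-identifies : ∀ a b → merge a b b ≡ merge a b a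
  merge-identifies a b rewrite ==-≡ {b} refl with a == b
  ... | true = refl
  ... | false = refl

  -- Z lists the top vertices of π, the top vertices of ρ, the bottom vertices of π, then those of ρ;
  -- positions P and Q hold the vertices k′ and (k+1)′, whose blocks • merges.  The blocks are
  -- distinct, as π uses labels below length π and the shifted ρ only labels above.
  module _ {k′ l′ π ρ} (dπ : IsDiagram (suc k′) π) (dρ : IsDiagram (suc l′) ρ) where
    private
      k = suc k′
      l = suc l′
      Z = juxtaposition k l π ρ
      t = π ⊗ ρ
      P = (k + l) + k′
      Q = (k + l) + k
      A₁ = take k π
      A₂ = drop k π
      S₁ = map (length π +_) (take l ρ)
      S₂ = map (length π +_) (drop l ρ)
      f = merge (nth t P) (nth t Q)

      lenA₁ : length A₁ ≡ k
      lenA₁ = length-take-half {k} dπ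
      lenA₂ : length A₂ ≡ k
      lenA₂ = length-drop-half {k} dπ
      lenS₁ : length S₁ ≡ l
      lenS₁ = trans (length-map _ (take l ρ)) (length-take-half {l} dρ)

      k′<lenA₂ : k′ < length A₂
      k′<lenA₂ = subst (k′ <_) (sym lenA₂) ≤-refl

      Z-P : nth Z P ≡ nth A₂ k′
      Z-P = begin
        nth Z P
          ≡⟨ cong (nth Z) (solve 3 (λ a b c → a :+ b :+ c := a :+ (b :+ c)) refl k l k′) ⟩
        nth Z (k + (l + k′))
          ≡⟨ cong (λ i → nth Z (i + (l + k′))) (sym lenA₁) ⟩
        nth Z (length A₁ + (l + k′))
          ≡⟨ nth-++ʳ A₁ _ (l + k′) ⟩
        nth (S₁ ++ A₂ ++ S₂) (l + k′)
          ≡⟨ cong (λ i → nth (S₁ ++ A₂ ++ S₂) (i + k′)) (sym lenS₁) ⟩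
        nth (S₁ ++ A₂ ++ S₂) (length S₁ + k′)
          ≡⟨ nth-++ʳ S₁ _ k′ ⟩
        nth (A₂ ++ S₂) k′
          ≡⟨ nth-++ˡ A₂ S₂ k′<lenA₂ ⟩
        nth A₂ k′ ∎
        where open ≡-Reasoning

      Z-Q : nth Z Q ≡ nth S₂ 0
      Z-Q = begin
        nth Z Q
          ≡⟨ cong (nth Z) (solve 3 (λ a b c → a :+ b :+ a := a :+ (b :+ (a :+ con 0))) refl k l k′) ⟩
        nth Z (k + (l + (k + 0)))
          ≡⟨ cong₂ (λ i j → nth Z (i + (l + (j + 0)))) (sym lenA₁) (sym lenA₂) ⟩
        nth Z (length A₁ + (l + (length A₂ + 0)))
          ≡⟨ nth-++ʳ A₁ _ (l + (length A₂ + 0)) ⟩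
        nth (S₁ ++ A₂ ++ S₂) (l + (length A₂ + 0))
          ≡⟨ cong (λ i → nth (S₁ ++ A₂ ++ S₂) (i + (length A₂ + 0))) (sym lenS₁) ⟩
        nth (S₁ ++ A₂ ++ S₂) (length S₁ + (length A₂ + 0))
          ≡⟨ nth-++ʳ S₁ _ (length A₂ + 0) ⟩
        nth (A₂ ++ S₂) (length A₂ + 0)
          ≡⟨ nth-++ʳ A₂ S₂ 0 ⟩
        nth S₂ 0 ∎
        where open ≡-Reasoning

      Z-P<length : nth Z P < length π
      Z-P<length = subst (_< length π) (sym Z-P) (All.lookup labelsA₂ (nth-∈ A₂ k′<lenA₂))
        where
        labelsA₂ : All (_< length π) A₂
        labelsA₂ = All.++⁻ʳ A₁ (subst (All (_< length π)) (sym (take++drop≡id k π)) (IsDiagram-bounded {k} dπ))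

      length≤Z-Q : length π ≤ nth Z Q
      length≤Z-Q rewrite Z-Q | nth-map (length π +_) (drop l ρ) {0} (subst (0 <_) (sym (length-drop-half {l} dρ)) z<s) =
        m≤m+n (length π) _

      Q<lengthZ : Q < length Z
      Q<lengthZ rewrite length-juxtaposition {k} {l} dπ dρ = +-monoʳ-< (k + l) (m<m+n k z<s)

      P<Q : P < Q
      P<Q = +-monoʳ-< (k + l) ≤-refl

      t≡normZ : t ≡ norm Z
      t≡normZ = ⊗≡norm-juxtaposition {k} {l} dπ dρ

      different-blocks : nth t Q ≢ nth t P
      different-blocks same = <⇒≱ Z-P<length (subst (length π ≤_) Z-Q≡Z-P length≤Z-Q)
        where
        Z-Q≡Z-P : nth Z Q ≡ nth Z P
        Z-Q≡Z-P = norm-reflects-nth-≡ Z Q<lengthZ (<-trans P<Q Q<lengthZ) (subst (λ u → nth u Q ≡ nth u P) t≡normZ same)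

      •≡norm-merge : π • ρ ≡ norm (map f t)
      •≡norm-merge rewrite ord-IsDiagram {k} dπ | ord-IsDiagram {l} dρ = refl

    •-IsDiagram : IsDiagram (k + l) (π • ρ)
    •-IsDiagram rewrite •≡norm-merge =
      trans (length-norm (map f t)) (trans (length-map f t) (proj₁ (⊗-IsDiagram {k} {l} dπ dρ))) ,
      norm-idempotent (map f t)

    coincidences-• : coincidences π + coincidences ρ < coincidences (π • ρ)
    coincidences-• rewrite •≡norm-merge | coincidences-norm (map f t) | sym (coincidences-⊗ {k} {l} dπ dρ) =
      coincidences-map-< f t P Q P<Q Q<length different-blocks (merge-identifies (nth t P) (nth t Q))
      where
      Q<length : Q < length t
      Q<length rewrite t≡normZ | length-norm Z = Q<lengthZ

  _⊴_ : List ℕ → List ℕ → Set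
  ρ ⊴ σ = ρ ≡ σ ⊎ coincidences ρ < coincidences σ

  fewer-coincidences⇒≢ : ∀ {ρ σ} → coincidences ρ < coincidences σ → ρ ≢ σ
  fewer-coincidences⇒≢ lt refl = <-irrefl refl lt

  ⊗-fewer-coincidences : ∀ {k l ρ₁ σ ρ₂ τ} → IsDiagram k ρ₁ → IsDiagram k σ → IsDiagram l ρ₂ → IsDiagram l τ →
    coincidences ρ₁ + coincidences ρ₂ < coincidences σ + coincidences τ →
    coincidences (ρ₁ ⊗ ρ₂) < coincidences (σ ⊗ τ)
  ⊗-fewer-coincidences {k} {l} d₁ dσ d₂ dτ =
    subst₂ _<_ (sym (coincidences-⊗ {k} {l} d₁ d₂)) (sym (coincidences-⊗ {k} {l} dσ dτ))

  ⊗-⊴ : ∀ {k l ρ₁ σ ρ₂ τ} → IsDiagram k ρ₁ → IsDiagram k σ → IsDiagram l ρ₂ → IsDiagram l τ →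
    ρ₁ ⊴ σ → ρ₂ ⊴ τ → (ρ₁ ≡ σ × ρ₂ ≡ τ) ⊎ coincidences (ρ₁ ⊗ ρ₂) < coincidences (σ ⊗ τ)
  ⊗-⊴ _ _ _ _ (inj₁ refl) (inj₁ refl) = inj₁ (refl , refl)
  ⊗-⊴ {k} {l} {ρ₁} d₁ dσ d₂ dτ (inj₁ refl) (inj₂ lt₂) =
    inj₂ (⊗-fewer-coincidences {k} {l} d₁ dσ d₂ dτ (+-monoʳ-< (coincidences ρ₁) lt₂))
  ⊗-⊴ {k} {l} {ρ₂ = ρ₂} d₁ dσ d₂ dτ (inj₂ lt₁) (inj₁ refl) =
    inj₂ (⊗-fewer-coincidences {k} {l} d₁ dσ d₂ dτ (+-monoˡ-< (coincidences ρ₂) lt₁))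
  ⊗-⊴ {k} {l} d₁ dσ d₂ dτ (inj₂ lt₁) (inj₂ lt₂) =
    inj₂ (⊗-fewer-coincidences {k} {l} d₁ dσ d₂ dτ (+-mono-< lt₁ lt₂))

module Counting where
  open import Data.Nat using (_≟_)
  open import Data.Bool using (true)
  open import Data.List.Properties using (≡-dec)
  open import Data.Empty using (⊥-elim)
  open import Relation.Nullary using (yes; no)
  open import Relation.Binary.PropositionalEquality using (refl)
  _≟L_ : DecidableEquality (List ℕ)
  _≟L_ = ≡-dec _≟_

  _≟LL_ : DecidableEquality (List (List ℕ))
  _≟LL_ = ≡-dec _≟L_

  =L⇒≡ : ∀ {σ τ} → σ =L τ ≡ true → σ ≡ τ
  =L⇒≡ {σ} {τ} eq with ≡-dec _≟_ σ τ
  ... | yes σ≡τ = σ≡τ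

  =L-refl : ∀ σ → σ =L σ ≡ true
  =L-refl σ with ≡-dec _≟_ σ σ
  ... | yes _ = refl
  ... | no σ≢σ = ⊥-elim (σ≢σ refl)

  module Labels = Multiplicity _≟_
  module Words = Multiplicity _≟L_
  module Tuples = Multiplicity _≟LL_

module Enumeration where
  open import Data.Nat
  open import Data.Nat.Properties
  open import Data.Nat.ListAction using (sum)
  open import Data.List using ([]; _∷_; [_]; _++_; map; length; upTo; concatMap)
  open import Data.List.Properties using (upTo-∷ʳ; ∷-injective; ∷-injectiveʳ)
  open import Data.List.Membership.Propositional using (_∉_; find)
  open import Data.List.Membership.Propositional.Properties using (∈-map⁻; ∈-concatMap⁻; ∈-upTo⁻; ∈-++⁻)
  open import Data.List.Relation.Unary.Any using (here)
  open import Data.List.Relation.Unary.Any.Properties using (¬Any[])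
  open import Data.List.Relation.Unary.All using ([]; _∷_)
  open import Data.List.Relation.Binary.Pointwise using (Pointwise; []; _∷_; Pointwise-length)
  open import Data.Product using (∃)
  open import Data.Empty using (⊥-elim)
  open import Data.Sum using (_⊎_; inj₁; inj₂)
  open import Relation.Nullary using (Dec; yes; no)
  open import Relation.Nullary.Decidable using (_×-dec_)
  open import Relation.Binary.PropositionalEquality using (_≢_; refl; sym; trans; cong; cong₂; subst; module ≡-Reasoning)
  open Counting
  open DiagramOperations using (ord-IsDiagram)
  open RestrictedGrowth
  open ListSum +-0-commutativeMonoid using (∑)

  ∈-concatMap⁻′ : ∀ {A B : Set} {y : B} (F : A → List B) xs → y ∈ concatMap F xs → ∃ λ x → x ∈ xs × y ∈ F x
  ∈-concatMap⁻′ F xs y∈ = find (∈-concatMap⁻ F y∈)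

  IsDiagram? : ∀ n σ → Dec (IsDiagram n σ)
  IsDiagram? n σ = (length σ ≟ n + n) ×-dec (norm σ ≟L σ)

  count-upTo : ∀ {x n} → x < n → Labels.count x (upTo n) ≡ 1
  count-upTo {x} {suc n} x<1+n = begin
    count x (upTo (suc n))              ≡⟨ cong (count x) (sym (upTo-∷ʳ n)) ⟩
    count x (upTo n ++ [ n ])           ≡⟨ count-++ x (upTo n) [ n ] ⟩
    count x (upTo n) + count x [ n ]    ≡⟨ last-or-earlier (m≤n⇒m<n∨m≡n (s≤s⁻¹ x<1+n)) ⟩
    1                                   ∎
    where
    open ≡-Reasoning
    open Labels
    last-or-earlier : x < n ⊎ x ≡ n → count x (upTo n) + count x [ n ] ≡ 1
    last-or-earlier (inj₁ x<n) = cong₂ _+_ (count-upTo x<n) (count-∉ [ n ] (λ { (here refl) → <-irrefl refl x<n }))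
    last-or-earlier (inj₂ refl) =
      cong₂ _+_ (count-∉ (upTo x) (λ x∈ → <-irrefl refl (∈-upTo⁻ x∈))) (count-≡-head {x} [] refl)

  count-map-∷ : ∀ x σ L → Words.count (x ∷ σ) (map (x ∷_) L) ≡ Words.count σ L
  count-map-∷ x σ [] = refl
  count-map-∷ x σ (τ ∷ L) = by-cases (τ ≟L σ)
    where
    open Words
    by-cases : Dec (τ ≡ σ) → count (x ∷ σ) (map (x ∷_) (τ ∷ L)) ≡ count σ (τ ∷ L)
    by-cases (yes refl) = trans (count-≡-head {x ∷ σ} (map (x ∷_) L) refl)
                                (trans (cong suc (count-map-∷ x σ L)) (sym (count-≡-head {σ} L refl)))
    by-cases (no τ≢σ) = trans (count-≢-head {x ∷ σ} {x ∷ τ} (map (x ∷_) L) (λ eq → τ≢σ (∷-injectiveʳ eq)))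
                              (trans (count-map-∷ x σ L) (sym (count-≢-head L τ≢σ)))

  count-map-∷-≢ : ∀ {x j} σ L → j ≢ x → Words.count (x ∷ σ) (map (j ∷_) L) ≡ 0
  count-map-∷-≢ {x} {j} σ L j≢x = Words.count-∉ (map (j ∷_) L) x∷σ∉
    where
    x∷σ∉ : x ∷ σ ∉ map (j ∷_) L
    x∷σ∉ x∷σ∈ with ∈-map⁻ (j ∷_) x∷σ∈
    ... | _ , _ , eq = j≢x (sym (proj₁ (∷-injective eq)))

  gen-sound : ∀ m b {σ} → σ ∈ gen m b → IsRGS b σ × length σ ≡ m
  gen-sound zero b (here refl) = [] , refl
  gen-sound (suc m) b σ∈ with ∈-concatMap⁻′ _ (upTo (suc b)) σ∈
  ... | j , j∈ , σ∈j with ∈-map⁻ (j ∷_) σ∈j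
  ...   | σ′ , σ′∈ , refl with gen-sound m (blocksAfter b j) σ′∈
  ...     | rgs , len = s≤s⁻¹ (∈-upTo⁻ j∈) ∷ rgs , cong suc len

  gen-complete : ∀ {b σ} → IsRGS b σ → Words.count σ (gen (length σ) b) ≡ 1
  gen-complete [] = refl
  gen-complete {b} {x ∷ σ} (x≤b ∷ rgs) = begin
    count (x ∷ σ) (concatMap extend (upTo (suc b)))
      ≡⟨ count-concatMap (x ∷ σ) extend (upTo (suc b)) ⟩
    ∑ (upTo (suc b)) (λ j → count (x ∷ σ) (extend j))
      ≡⟨ Labels.∑-concentrated-once +-0-commutativeMonoid (upTo (suc b)) x (count-upTo (s≤s x≤b))
           (λ {j} _ j≢x → count-map-∷-≢ σ (gen (length σ) (blocksAfter b j)) j≢x) ⟩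
    count (x ∷ σ) (extend x)
      ≡⟨ count-map-∷ x σ (gen (length σ) (blocksAfter b x)) ⟩
    count σ (gen (length σ) (blocksAfter b x))
      ≡⟨ gen-complete rgs ⟩
    1 ∎
    where
    open ≡-Reasoning
    open Words
    extend : ℕ → List (List ℕ)
    extend j = map (j ∷_) (gen (length σ) (blocksAfter b j))

  diagrams-sound : ∀ k {σ} → σ ∈ diagrams k → IsDiagram k σ
  diagrams-sound k σ∈ with gen-sound (k + k) 0 σ∈
  ... | rgs , len = len , IsRGS⇒normal rgs

  diagrams-complete : ∀ {k σ} → IsDiagram k σ → Words.count σ (diagrams k) ≡ 1
  diagrams-complete {k} {σ} (len , normal) = subst (λ m → Words.count σ (gen m 0) ≡ 1) len (gen-complete (normal⇒IsRGS normal))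

  -- compositions uses a where-bound helper, which cannot be named here; unification supplies it.
  compositions-step : ∀ m → ∃ λ (F : List ℕ → List (List ℕ)) →
    (F [] ≡ [] × (∀ a as → F (a ∷ as) ≡ [ suc a ∷ as ])) ×
    compositions (suc m) ≡ map (1 ∷_) (compositions m) ++ concatMap F (compositions m)
  compositions-step m = _ , (refl , λ _ _ → refl) , refl

  IsComposition : ℕ → List ℕ → Set
  IsComposition n c = All (0 <_) c × sum c ≡ n

  compositions-sound : ∀ n {c} → c ∈ compositions n → IsComposition n c
  compositions-sound zero (here refl) = [] , refl
  compositions-sound (suc m) {c} c∈ with compositions-step m
  ... | F , (F[] , F∷) , step with ∈-++⁻ (map (1 ∷_) (compositions m)) (subst (c ∈_) step c∈)
  ...   | inj₁ c∈ones with ∈-map⁻ (1 ∷_) c∈ones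
  ...     | c′ , c′∈ , refl with compositions-sound m c′∈
  ...       | pos , total = z<s ∷ pos , cong suc total
  compositions-sound (suc m) {c} c∈ | F , (F[] , F∷) , step | inj₂ c∈incr with ∈-concatMap⁻′ F (compositions m) c∈incr
  ... | [] , _ , c∈F[] rewrite F[] = ⊥-elim (¬Any[] c∈F[])
  ... | a ∷ as , c′∈ , c∈F rewrite F∷ a as with c∈F | compositions-sound m c′∈
  ...   | here refl | a>0 ∷ pos , total = z<s ∷ pos , cong suc total

  compositions-single : ∀ m → Words.count [ suc m ] (compositions (suc m)) ≡ 1
  compositions-single zero = refl
  compositions-single (suc m) with compositions-step (suc m)
  ... | F , (F[] , F∷) , step = begin
    count [ 2+ m ] (compositions (2+ m))
      ≡⟨ cong (count [ 2+ m ]) step ⟩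
    count [ 2+ m ] (map (1 ∷_) cs ++ concatMap F cs)
      ≡⟨ count-++ [ 2+ m ] (map (1 ∷_) cs) (concatMap F cs) ⟩
    count [ 2+ m ] (map (1 ∷_) cs) + count [ 2+ m ] (concatMap F cs)
      ≡⟨ cong₂ _+_ (count-map-∷-≢ [] cs (λ ())) (count-concatMap [ 2+ m ] F cs) ⟩
    ∑ cs (λ c → count [ 2+ m ] (F c))
      ≡⟨ ∑-concentrated-once +-0-commutativeMonoid cs [ suc m ] (compositions-single m) (λ {c} _ → vanish c) ⟩
    count [ 2+ m ] (F [ suc m ])
      ≡⟨ cong (count [ 2+ m ]) (F∷ (suc m) []) ⟩
    count [ 2+ m ] [ [ 2+ m ] ]
      ≡⟨ count-≡-head {[ 2+ m ]} [] refl ⟩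
    1 ∎
    where
    open ≡-Reasoning
    open Words
    cs = compositions (suc m)
    vanish : ∀ c → c ≢ [ suc m ] → count [ 2+ m ] (F c) ≡ 0
    vanish [] _ rewrite F[] = refl
    vanish (a ∷ as) c≢ rewrite F∷ a as = count-∉ [ suc a ∷ as ] λ { (here eq) → c≢ (same eq) }
      where
      same : [ 2+ m ] ≡ suc a ∷ as → a ∷ as ≡ [ suc m ]
      same refl = refl

  choices-sound : ∀ c {ρs} → ρs ∈ choices c → Pointwise IsDiagram c ρs
  choices-sound [] (here refl) = []
  choices-sound (a ∷ as) ρs∈ with ∈-concatMap⁻′ (λ ρ → map (ρ ∷_) (choices as)) (diagrams a) ρs∈
  ... | ρ , ρ∈ , ρs∈ρ with ∈-map⁻ (ρ ∷_) ρs∈ρ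
  ...   | ρs′ , ρs′∈ , refl = diagrams-sound a ρ∈ ∷ choices-sound as ρs′∈

  tuples-sound : ∀ n {ρs} → ρs ∈ tuples n → ∃ λ c → IsComposition n c × Pointwise IsDiagram c ρs
  tuples-sound n ρs∈ with ∈-concatMap⁻′ choices (compositions n) ρs∈
  ... | c , c∈ , ρs∈c = c , compositions-sound n c∈ , choices-sound c ρs∈c

  count-singletons : ∀ τ D → Tuples.count [ τ ] (concatMap (λ ρ → map (ρ ∷_) [ [] ]) D) ≡ Words.count τ D
  count-singletons τ [] = refl
  count-singletons τ (ρ ∷ D) = by-cases (ρ ≟L τ)
    where
    by-cases : Dec (ρ ≡ τ) → Tuples.count [ τ ] (concatMap (λ ρ → map (ρ ∷_) [ [] ]) (ρ ∷ D)) ≡ Words.count τ (ρ ∷ D)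
    by-cases (yes refl) = trans (Tuples.count-≡-head {[ τ ]} _ refl)
                                (trans (cong suc (count-singletons τ D)) (sym (Words.count-≡-head {τ} D refl)))
    by-cases (no ρ≢τ) = trans (Tuples.count-≢-head {[ τ ]} {[ ρ ]} _ (λ eq → ρ≢τ (proj₁ (∷-injective eq))))
                              (trans (count-singletons τ D) (sym (Words.count-≢-head D ρ≢τ)))

  tuples-single : ∀ {m τ} → IsDiagram (suc m) τ → Tuples.count [ τ ] (tuples (suc m)) ≡ 1
  tuples-single {m} {τ} dτ = begin
    count [ τ ] (concatMap choices cs)
      ≡⟨ count-concatMap [ τ ] choices cs ⟩
    ∑ cs (λ c → count [ τ ] (choices c))
      ≡⟨ Words.∑-concentrated-once +-0-commutativeMonoid cs [ suc m ] (compositions-single m) (λ {c} _ → vanish c) ⟩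
    count [ τ ] (choices [ suc m ])
      ≡⟨ count-singletons τ (diagrams (suc m)) ⟩
    Words.count τ (diagrams (suc m))
      ≡⟨ diagrams-complete {suc m} dτ ⟩
    1 ∎
    where
    open ≡-Reasoning
    open Tuples
    cs = compositions (suc m)
    vanish : ∀ c → c ≢ [ suc m ] → count [ τ ] (choices c) ≡ 0
    vanish [] _ = count-∉ {[ τ ]} [ [] ] λ { (here ()) }
    vanish (a ∷ []) c≢ = trans (count-singletons τ (diagrams a)) (Words.count-∉ (diagrams a) τ∉)
      where
      τ∉ : τ ∉ diagrams a
      τ∉ τ∈ = c≢ (cong [_] (trans (sym (ord-IsDiagram {a} (diagrams-sound a τ∈))) (ord-IsDiagram {suc m} dτ)))
    vanish (a ∷ b ∷ as) _ =
      count-∉ (choices (a ∷ b ∷ as)) λ τ∈ → lengths-differ (Pointwise-length (choices-sound (a ∷ b ∷ as) τ∈))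
      where lengths-differ : suc (suc (length as)) ≢ 1
            lengths-differ ()

module Factorisation where
  open import Data.Nat
  open import Data.Nat.Properties
  open import Data.Bool using (true; false; if_then_else_)
  open import Data.Maybe using (Maybe; just; nothing)
  open import Data.List using ([]; _∷_; [_]; map; concatMap; applyUpTo; foldr)
  open import Data.List.Membership.Propositional.Properties using (∈-map⁻; ∈-applyUpTo⁻)
  open import Data.List.Relation.Unary.Any using (here; there)
  open import Data.List.Relation.Unary.All using ([]; _∷_)
  open import Data.List.Relation.Binary.Pointwise using (Pointwise; []; _∷_)
  open import Data.Product using (∃; ∃₂)
  open import Relation.Binary.PropositionalEquality using (refl; sym; trans; cong; subst)
  open Counting
  open DiagramOperations using (ord-IsDiagram; ⊗-identityʳ)
  open Enumeration

  splitsOfOrder : ℕ → List (List ℕ × List ℕ)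
  splitsOfOrder n = concatMap (λ i → concatMap (λ ρ₁ → map (ρ₁ ,_) (diagrams (n ∸ i))) (diagrams i))
                              (applyUpTo suc (n ∸ 1))

  splitCandidates : List ℕ → List (List ℕ × List ℕ)
  splitCandidates π = splitsOfOrder (ord π)

  SplitSearch : Set
  SplitSearch = List ℕ → List (List ℕ × List ℕ) → Maybe (List ℕ × List ℕ)

  -- Likewise for the where-bound search inside firstSplit.
  firstSplit-search : ∃ λ (first : SplitSearch) →
    (∀ π ρ₁ ρ₂ r → first π ((ρ₁ , ρ₂) ∷ r) ≡ (if (ρ₁ ⊗ ρ₂) =L π then just (ρ₁ , ρ₂) else first π r)) ×
    (∀ π → firstSplit π ≡ first π (splitCandidates π))
  firstSplit-search = first , (λ _ _ _ _ → refl) , unfold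
    where
    first : SplitSearch
    first = _
    unfold : ∀ π → firstSplit π ≡ first π (splitCandidates π)
    unfold π with splitCandidates π
    ... | r = refl

  firstJust : SplitSearch
  firstJust = proj₁ firstSplit-search

  firstJust-sound : ∀ π r {ρ₁ ρ₂} → firstJust π r ≡ just (ρ₁ , ρ₂) → (ρ₁ , ρ₂) ∈ r × ρ₁ ⊗ ρ₂ ≡ π
  firstJust-sound π [] ()
  firstJust-sound π ((σ₁ , σ₂) ∷ r) found
    rewrite proj₁ (proj₂ firstSplit-search) π σ₁ σ₂ r with (σ₁ ⊗ σ₂) =L π in eq
  firstJust-sound π ((σ₁ , σ₂) ∷ r) refl | true = here refl , =L⇒≡ eq
  ... | false with firstJust-sound π r found
  ...   | ∈r , ⊗≡ = there ∈r , ⊗≡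

  splitsOfOrder-sound : ∀ {n ρ₁ ρ₂} → (ρ₁ , ρ₂) ∈ splitsOfOrder (suc n) →
    ∃₂ λ i j → i + suc j ≡ n × IsDiagram (suc i) ρ₁ × IsDiagram (suc j) ρ₂
  splitsOfOrder-sound {n} ∈splits with ∈-concatMap⁻′ _ (applyUpTo suc n) ∈splits
  ... | _ , i∈ , ∈splits-i with ∈-applyUpTo⁻ suc i∈
  ...   | i , i<n , refl with ∈-concatMap⁻′ _ (diagrams (suc i)) ∈splits-i
  ...     | ρ₁ , ρ₁∈ , ∈pairs with ∈-map⁻ (ρ₁ ,_) ∈pairs
  ...       | ρ₂ , ρ₂∈ , refl with m≤n⇒∃[o]m+o≡n i<n
  ...         | j , refl = i , j , +-suc i j , diagrams-sound (suc i) ρ₁∈ ,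
                            subst (λ m → IsDiagram m ρ₂) order₂ (diagrams-sound (suc (i + j) ∸ i) ρ₂∈)
    where
    order₂ : suc (i + j) ∸ i ≡ suc j
    order₂ = trans (cong (_∸ i) (sym (+-suc i j))) (m+n∸m≡n i (suc j))

  firstSplit-sound : ∀ {n π ρ₁ ρ₂} → IsDiagram (suc n) π → firstSplit π ≡ just (ρ₁ , ρ₂) →
    ρ₁ ⊗ ρ₂ ≡ π × ∃₂ λ i j → i + suc j ≡ n × IsDiagram (suc i) ρ₁ × IsDiagram (suc j) ρ₂
  firstSplit-sound {n} {π} dπ found
    with firstJust-sound π (splitCandidates π) (trans (sym (proj₂ (proj₂ firstSplit-search) π)) found)
  ... | ∈cands , ⊗≡π = ⊗≡π , splitsOfOrder-sound (subst (λ m → _ ∈ splitsOfOrder m) (ord-IsDiagram {suc n} dπ) ∈cands)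

  IsFactorisation : ℕ → List ℕ → List (List ℕ) → Set
  IsFactorisation n π τs = ∃ λ c → IsComposition n c × Pointwise IsDiagram c τs × foldr _⊗_ [] τs ≡ π

  factorsF-sound : ∀ f {n π} → IsDiagram (suc n) π → n < f → IsFactorisation (suc n) π (factorsF f π)
  factorsF-sound (suc f) {n} {π} dπ n<1+f with firstSplit π in found
  ... | nothing = [ suc n ] , (z<s ∷ [] , +-identityʳ (suc n)) , dπ ∷ [] , ⊗-identityʳ {suc n} dπ
  ... | just (ρ₁ , ρ₂) with firstSplit-sound dπ found
  ...   | ⊗≡π , i , j , refl , d₁ , d₂
    with factorsF-sound f d₂ (<-≤-trans (n<1+n j) (≤-trans (m≤n+m (suc j) i) (s≤s⁻¹ n<1+f)))
  ...     | c , (pos , total) , dτs , fold≡ =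
    suc i ∷ c , (z<s ∷ pos , cong (suc i +_) total) , d₁ ∷ dτs , trans (cong (ρ₁ ⊗_) fold≡) ⊗≡π

  factors-sound : ∀ {n π} → IsDiagram n π → IsFactorisation n π (factors π)
  factors-sound {zero} {[]} _ = [] , ([] , refl) , [] , refl
  factors-sound {suc n} dπ rewrite ord-IsDiagram {suc n} dπ = factorsF-sound (suc n) dπ ≤-refl

module Coefficients {c ℓ} (K : Field c ℓ) where
  open import Level using (_⊔_)
  open import Data.Nat using (zero; suc)
  open import Data.List using ([]; _∷_; _++_; concatMap)
  open import Data.List.Properties using (concatMap-++)
  open import Data.List.Relation.Unary.All using ([]; _∷_)
  open import Data.Product using (∃)
  open import Data.Empty using (⊥-elim)
  open import Relation.Nullary using (¬_; Dec; yes; no)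
  import Relation.Binary.PropositionalEquality as ≡
  open ≡ using (_≢_)
  open Counting using (_≟L_; module Words)
  open Field K renaming (_+_ to _+K_; _*_ to _*K_)
  open ParSym K
  open ListSum +-commutativeMonoid using (∑; ∑-cong; ∑-distrib; ∑-vanishing)
  open import Algebra.Properties.Ring ring using (-‿distribˡ-*; -‿distribʳ-*; -‿involutive)
  open import Relation.Binary.Reasoning.Setoid setoid

  when : ∀ {p} {P : Set p} → Dec P → Carrier → Carrier
  when (yes _) a = a
  when (no _) a = 0#

  when-yes : ∀ {p} {P : Set p} (d : Dec P) a → P → when d a ≈ a
  when-yes (yes _) a _ = refl
  when-yes (no ¬p) a p = ⊥-elim (¬p p)

  when-no : ∀ {p} {P : Set p} (d : Dec P) a → ¬ P → when d a ≈ 0#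
  when-no (yes p) a ¬p = ⊥-elim (¬p p)
  when-no (no _) a _ = refl

  when-cong : ∀ {p} {P : Set p} (d : Dec P) {a b} → a ≈ b → when d a ≈ when d b
  when-cong (yes _) a≈b = a≈b
  when-cong (no _) _ = refl

  coeff-∷ : ∀ a L v ρ → coeff ((a , L) ∷ v) ρ ≈ when (L ≟L ρ) a +K coeff v ρ
  coeff-∷ a L v ρ with L ≟L ρ
  ... | yes _ = refl
  ... | no _ = sym (+-identityˡ _)

  coeff-++ : ∀ v w ρ → coeff (v ++ w) ρ ≈ coeff v ρ +K coeff w ρ
  coeff-++ [] w ρ = sym (+-identityˡ _)
  coeff-++ ((a , L) ∷ v) w ρ = begin
    coeff ((a , L) ∷ v ++ w) ρ                   ≈⟨ coeff-∷ a L (v ++ w) ρ ⟩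
    when (L ≟L ρ) a +K coeff (v ++ w) ρ          ≈⟨ +-congˡ (coeff-++ v w ρ) ⟩
    when (L ≟L ρ) a +K (coeff v ρ +K coeff w ρ)  ≈⟨ sym (+-assoc _ _ _) ⟩
    (when (L ≟L ρ) a +K coeff v ρ) +K coeff w ρ  ≈⟨ +-congʳ (sym (coeff-∷ a L v ρ)) ⟩
    coeff ((a , L) ∷ v) ρ +K coeff w ρ           ∎

  when-* : ∀ {p} {P : Set p} (d : Dec P) b a → when d (b *K a) ≈ b *K when d a
  when-* (yes _) b a = refl
  when-* (no _) b a = sym (zeroʳ b)

  coeff-scale : ∀ b v ρ → coeff (scale b v) ρ ≈ b *K coeff v ρ
  coeff-scale b [] ρ = sym (zeroʳ b)
  coeff-scale b ((a , L) ∷ v) ρ = begin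
    coeff ((b *K a , L) ∷ scale b v) ρ                ≈⟨ coeff-∷ (b *K a) L (scale b v) ρ ⟩
    when (L ≟L ρ) (b *K a) +K coeff (scale b v) ρ     ≈⟨ +-cong (when-* (L ≟L ρ) b a) (coeff-scale b v ρ) ⟩
    b *K when (L ≟L ρ) a +K b *K coeff v ρ            ≈⟨ sym (distribˡ b _ _) ⟩
    b *K (when (L ≟L ρ) a +K coeff v ρ)               ≈⟨ *-congˡ (sym (coeff-∷ a L v ρ)) ⟩
    b *K coeff ((a , L) ∷ v) ρ                        ∎

  coeff-concatMap : ∀ {a} {A : Set a} (F : A → PS) xs ρ → coeff (concatMap F xs) ρ ≈ ∑ xs (λ x → coeff (F x) ρ)
  coeff-concatMap F [] ρ = refl
  coeff-concatMap F (x ∷ xs) ρ = trans (coeff-++ (F x) (concatMap F xs) ρ) (+-congˡ (coeff-concatMap F xs ρ))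

  coeff-absent : ∀ v ρ → All (λ t → proj₂ t ≢ ρ) v → coeff v ρ ≈ 0#
  coeff-absent [] ρ [] = refl
  coeff-absent ((a , L) ∷ v) ρ (L≢ρ ∷ absent) with L ≟L ρ
  ... | yes L≡ρ = ⊥-elim (L≢ρ L≡ρ)
  ... | no _ = coeff-absent v ρ absent

  coeff-H : ∀ L ρ → coeff (H L) ρ ≈ when (L ≟L ρ) 1#
  coeff-H L ρ = trans (coeff-∷ 1# L [] ρ) (+-identityʳ _)

  combination : (List ℕ → PS) → PS → PS
  combination F cs = concatMap (λ t → scale (proj₁ t) (F (proj₂ t))) cs

  coeff-combination : ∀ F cs ρ → coeff (combination F cs) ρ ≈ ∑ cs (λ t → proj₁ t *K coeff (F (proj₂ t)) ρ)
  coeff-combination F cs ρ = trans (coeff-concatMap _ cs ρ) (∑-cong cs (λ {t} _ → coeff-scale (proj₁ t) (F (proj₂ t)) ρ))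

  ∑-regroup : ∀ D (f : List ℕ → Carrier) cs → All (λ t → Words.count (proj₂ t) D ≡ 1) cs →
    ∑ cs (λ t → proj₁ t *K f (proj₂ t)) ≈ ∑ D (λ ρ → coeff cs ρ *K f ρ)
  ∑-regroup D f [] [] = sym (∑-vanishing D (λ _ → zeroˡ _))
  ∑-regroup D f ((a , L) ∷ cs) (once ∷ onces) = begin
    a *K f L +K ∑ cs (λ t → proj₁ t *K f (proj₂ t))
      ≈⟨ +-cong (sym single) (∑-regroup D f cs onces) ⟩
    ∑ D (λ ρ → when (L ≟L ρ) a *K f ρ) +K ∑ D (λ ρ → coeff cs ρ *K f ρ)
      ≈⟨ sym (∑-distrib D _ _) ⟩
    ∑ D (λ ρ → when (L ≟L ρ) a *K f ρ +K coeff cs ρ *K f ρ)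
      ≈⟨ ∑-cong D (λ {ρ} _ → sym (distribʳ (f ρ) _ _)) ⟩
    ∑ D (λ ρ → (when (L ≟L ρ) a +K coeff cs ρ) *K f ρ)
      ≈⟨ ∑-cong D (λ {ρ} _ → *-congʳ (sym (coeff-∷ a L cs ρ))) ⟩
    ∑ D (λ ρ → coeff ((a , L) ∷ cs) ρ *K f ρ) ∎
    where
    single : ∑ D (λ ρ → when (L ≟L ρ) a *K f ρ) ≈ a *K f L
    single = trans (Words.∑-concentrated-once +-commutativeMonoid D L once
                      (λ {ρ} _ ρ≢L → trans (*-congʳ (when-no (L ≟L ρ) a (λ L≡ρ → ρ≢L (≡.sym L≡ρ)))) (zeroˡ _)))
                   (*-congʳ (when-yes (L ≟L L) a ≡.refl))

  Invertible : Carrier → Set (c ⊔ ℓ)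
  Invertible u = ∃ λ v → u *K v ≈ 1#

  invertible-cong : ∀ {u u′} → u ≈ u′ → Invertible u → Invertible u′
  invertible-cong u≈u′ (v , uv≈1) = v , trans (*-congʳ (sym u≈u′)) uv≈1

  invertible-* : ∀ {u u′} → Invertible u → Invertible u′ → Invertible (u *K u′)
  invertible-* {u} {u′} (v , uv≈1) (v′ , u′v′≈1) = v′ *K v , (begin
    (u *K u′) *K (v′ *K v)   ≈⟨ *-assoc u u′ _ ⟩
    u *K (u′ *K (v′ *K v))   ≈⟨ *-congˡ (sym (*-assoc u′ v′ v)) ⟩
    u *K ((u′ *K v′) *K v)   ≈⟨ *-congˡ (*-congʳ u′v′≈1) ⟩
    u *K (1# *K v)           ≈⟨ *-congˡ (*-identityˡ v) ⟩
    u *K v                   ≈⟨ uv≈1 ⟩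
    1#                       ∎)

  invertible-1 : Invertible 1#
  invertible-1 = 1# , *-identityˡ 1#

  invertible-sign : ∀ m → Invertible (sign m)
  invertible-sign m = sign m , sign-squared m
    where
    sign-squared : ∀ m → sign m *K sign m ≈ 1#
    sign-squared zero = *-identityˡ 1#
    sign-squared (suc m) = begin
      - sign m *K - sign m      ≈⟨ sym (-‿distribˡ-* (sign m) (- sign m)) ⟩
      - (sign m *K - sign m)    ≈⟨ -‿cong (sym (-‿distribʳ-* (sign m) (sign m))) ⟩
      - - (sign m *K sign m)    ≈⟨ -‿involutive _ ⟩
      sign m *K sign m          ≈⟨ sign-squared m ⟩
      1#                        ∎

  invertible-cancel : ∀ {u} a → Invertible u → a *K u ≈ 0# → a ≈ 0#
  invertible-cancel {u} a (v , uv≈1) au≈0 = begin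
    a                 ≈⟨ sym (*-identityʳ a) ⟩
    a *K 1#           ≈⟨ *-congˡ (sym uv≈1) ⟩
    a *K (u *K v)     ≈⟨ sym (*-assoc a u v) ⟩
    (a *K u) *K v     ≈⟨ *-congʳ au≈0 ⟩
    0# *K v           ≈⟨ zeroˡ v ⟩
    0#                ∎

  coeff-combination-++ : ∀ F xs ys ρ →
    coeff (combination F (xs ++ ys)) ρ ≈ coeff (combination F xs) ρ +K coeff (combination F ys) ρ
  coeff-combination-++ F xs ys ρ rewrite concatMap-++ (λ t → scale (proj₁ t) (F (proj₂ t))) xs ys =
    coeff-++ (combination F xs) (combination F ys) ρ

  coeff-combination-scale : ∀ F a cs ρ → coeff (combination F (scale a cs)) ρ ≈ a *K coeff (combination F cs) ρ
  coeff-combination-scale F a [] ρ = sym (zeroʳ a)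
  coeff-combination-scale F a ((b , σ) ∷ cs) ρ = begin
    coeff (scale (a *K b) (F σ) ++ combination F (scale a cs)) ρ
      ≈⟨ coeff-++ (scale (a *K b) (F σ)) _ ρ ⟩
    coeff (scale (a *K b) (F σ)) ρ +K coeff (combination F (scale a cs)) ρ
      ≈⟨ +-cong (coeff-scale (a *K b) (F σ) ρ) (coeff-combination-scale F a cs ρ) ⟩
    (a *K b) *K coeff (F σ) ρ +K a *K coeff (combination F cs) ρ
      ≈⟨ +-congʳ (*-assoc a b _) ⟩
    a *K (b *K coeff (F σ) ρ) +K a *K coeff (combination F cs) ρ
      ≈⟨ sym (distribˡ a _ _) ⟩
    a *K (b *K coeff (F σ) ρ +K coeff (combination F cs) ρ)
      ≈⟨ *-congˡ (+-congʳ (sym (coeff-scale b (F σ) ρ))) ⟩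
    a *K (coeff (scale b (F σ)) ρ +K coeff (combination F cs) ρ)
      ≈⟨ *-congˡ (sym (coeff-++ (scale b (F σ)) _ ρ)) ⟩
    a *K coeff (combination F ((b , σ) ∷ cs)) ρ ∎

module BulletProducts where
  open import Data.Nat using (suc; _+_; _<_; _≤_; z<s)
  import Data.Nat.Properties as ℕ
  open import Data.Nat.ListAction using (sum)
  open import Data.List using ([]; _∷_; [_]; map; foldr; foldl)
  open import Data.List.Relation.Unary.All using ([]; _∷_)
  open import Data.List.Relation.Binary.Pointwise using (Pointwise; []; _∷_)
  open import Data.Sum using (_⊎_; inj₁; inj₂)
  open import Relation.Binary.PropositionalEquality using (refl; sym; trans; cong; subst)
  open Coincidences
  open Enumeration using (tuples-sound)
  open DiagramOperations

  fold⊗ : List (List ℕ) → List ℕ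
  fold⊗ = foldr _⊗_ []

  fold⊗-IsDiagram : ∀ {c ρs} → Pointwise IsDiagram c ρs → IsDiagram (sum c) (fold⊗ ρs)
  fold⊗-IsDiagram [] = refl , refl
  fold⊗-IsDiagram {a ∷ c} (dρ ∷ dρs) = ⊗-IsDiagram {a} {sum c} dρ (fold⊗-IsDiagram dρs)

  coincidences-fold⊗ : ∀ {c ρs} → Pointwise IsDiagram c ρs → coincidences (fold⊗ ρs) ≡ sum (map coincidences ρs)
  coincidences-fold⊗ [] = refl
  coincidences-fold⊗ {a ∷ c} {ρ ∷ ρs} (dρ ∷ dρs) =
    trans (coincidences-⊗ {a} {sum c} dρ (fold⊗-IsDiagram dρs)) (cong (coincidences ρ +_) (coincidences-fold⊗ dρs))

  coincidences-foldl-• : ∀ {k acc c ρs} → IsDiagram (suc k) acc → Pointwise IsDiagram c ρs → All (0 <_) c →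
    coincidences acc + sum (map coincidences ρs) ≤ coincidences (foldl _•_ acc ρs)
  coincidences-foldl-• {acc = acc} dacc [] [] = ℕ.≤-reflexive (ℕ.+-identityʳ (coincidences acc))
  coincidences-foldl-• {acc = acc} {suc a ∷ c} {ρ ∷ ρs} dacc (dρ ∷ dρs) (z<s ∷ pos) = begin
    coincidences acc + (coincidences ρ + sum (map coincidences ρs))
      ≡⟨ sym (ℕ.+-assoc (coincidences acc) _ _) ⟩
    coincidences acc + coincidences ρ + sum (map coincidences ρs)
      ≤⟨ ℕ.+-monoˡ-≤ _ (ℕ.<⇒≤ (coincidences-• dacc dρ)) ⟩
    coincidences (acc • ρ) + sum (map coincidences ρs)
      ≤⟨ coincidences-foldl-• (•-IsDiagram dacc dρ) dρs pos ⟩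
    coincidences (foldl _•_ (acc • ρ) ρs) ∎
    where open ℕ.≤-Reasoning

  fold⊗-below-bulletFold : ∀ {m τ ρs} → ρs ∈ tuples (suc m) → bulletFold ρs ≡ τ →
    IsDiagram (suc m) (fold⊗ ρs) × (ρs ≡ [ τ ] ⊎ coincidences (fold⊗ ρs) < coincidences τ)
  fold⊗-below-bulletFold {m} {τ} {ρs} ρs∈ bullet≡τ with tuples-sound (suc m) ρs∈
  ... | c , (pos , total) , dρs =
    subst (λ n → IsDiagram n (fold⊗ ρs)) total (fold⊗-IsDiagram dρs) , shape dρs pos total bullet≡τ
    where
    shape : ∀ {c ρs} → Pointwise IsDiagram c ρs → All (0 <_) c → sum c ≡ suc m → bulletFold ρs ≡ τ →
      ρs ≡ [ τ ] ⊎ coincidences (fold⊗ ρs) < coincidences τ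
    shape [] [] () _
    shape (_ ∷ []) _ _ refl = inj₁ refl
    shape {suc a₁ ∷ suc a₂ ∷ c} {ρ₁ ∷ ρ₂ ∷ ρs} (d₁ ∷ d₂ ∷ dρs) (z<s ∷ z<s ∷ pos) _ refl = inj₂ (begin-strict
      coincidences (fold⊗ (ρ₁ ∷ ρ₂ ∷ ρs))
        ≡⟨ coincidences-fold⊗ {suc a₁ ∷ suc a₂ ∷ c} (d₁ ∷ d₂ ∷ dρs) ⟩
      coincidences ρ₁ + (coincidences ρ₂ + sum (map coincidences ρs))
        ≡⟨ sym (ℕ.+-assoc (coincidences ρ₁) _ _) ⟩
      coincidences ρ₁ + coincidences ρ₂ + sum (map coincidences ρs)
        <⟨ ℕ.+-monoˡ-< _ (coincidences-• d₁ d₂) ⟩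
      coincidences (ρ₁ • ρ₂) + sum (map coincidences ρs)
        ≤⟨ coincidences-foldl-• (•-IsDiagram d₁ d₂) dρs pos ⟩
      coincidences (foldl _•_ (ρ₁ • ρ₂) ρs) ∎)
      where open ℕ.≤-Reasoning

module Triangularity {c ℓ} (K : Field c ℓ) where
  open import Data.Nat using (suc; _+_; _<_; z<s)
  open import Data.Nat.ListAction using (sum)
  open import Data.Bool using (true; false; if_then_else_)
  open import Data.List using ([]; _∷_; [_]; _++_; map; concatMap; foldr; length)
  open import Data.List.Relation.Unary.All as All using ([]; _∷_)
  import Data.List.Relation.Unary.All.Properties as All
  open import Data.List.Relation.Binary.Pointwise using (Pointwise; []; _∷_)
  open import Data.Product using (∃)
  open import Data.Sum using (_⊎_; inj₁; inj₂)
  open import Data.Empty using (⊥-elim)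
  open import Relation.Nullary using (yes; no)
  import Relation.Binary.PropositionalEquality as ≡
  open ≡ using (_≢_)
  open Counting
  open Field K renaming (_+_ to _+K_; _*_ to _*K_)
  open ParSym K
  open Coefficients K
  open DiagramOperations using (_⊴_; ⊗-⊴; fewer-coincidences⇒≢; ⊗-IsDiagram; ⊗-identityʳ; ord-IsDiagram)
  open Enumeration using (tuples-single)
  open Factorisation using (factors-sound)
  open ListSum +-commutativeMonoid using (∑)
  open import Relation.Binary.Reasoning.Setoid setoid

  Triangular : ℕ → List ℕ → PS → Set c
  Triangular k σ v = All (λ t → IsDiagram k (proj₂ t) × proj₂ t ⊴ σ) v

  module _ {k l σ τ} (dσ : IsDiagram k σ) (dτ : IsDiagram l τ) where

    ⊗-reflects-diagonal : ∀ {ρ₁ ρ₂} → IsDiagram k ρ₁ → IsDiagram l ρ₂ → ρ₁ ⊴ σ → ρ₂ ⊴ τ →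
      ρ₁ ⊗ ρ₂ ≡ σ ⊗ τ → ρ₁ ≡ σ × ρ₂ ≡ τ
    ⊗-reflects-diagonal d₁ d₂ below₁ below₂ same with ⊗-⊴ {k} {l} d₁ dσ d₂ dτ below₁ below₂
    ... | inj₁ diagonal = diagonal
    ... | inj₂ fewer = ⊥-elim (fewer-coincidences⇒≢ fewer same)

    when-⊗ : ∀ {ρ₁ ρ₂} → IsDiagram k ρ₁ → IsDiagram l ρ₂ → ρ₁ ⊴ σ → ρ₂ ⊴ τ → ∀ a b →
      when ((ρ₁ ⊗ ρ₂) ≟L (σ ⊗ τ)) (a *K b) ≈ when (ρ₁ ≟L σ) a *K when (ρ₂ ≟L τ) b
    when-⊗ {ρ₁} {ρ₂} d₁ d₂ below₁ below₂ a b with (ρ₁ ⊗ ρ₂) ≟L (σ ⊗ τ) | ρ₁ ≟L σ | ρ₂ ≟L τ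
    ... | yes _ | yes _ | yes _ = refl
    ... | no _ | no _ | _ = sym (zeroˡ _)
    ... | no _ | yes _ | no _ = sym (zeroʳ _)
    ... | no ⊗≢ | yes ρ₁≡σ | yes ρ₂≡τ = ⊥-elim (⊗≢ (≡.cong₂ _⊗_ ρ₁≡σ ρ₂≡τ))
    ... | yes ⊗≡ | no ρ₁≢σ | _ = ⊥-elim (ρ₁≢σ (proj₁ (⊗-reflects-diagonal d₁ d₂ below₁ below₂ ⊗≡)))
    ... | yes ⊗≡ | _ | no ρ₂≢τ = ⊥-elim (ρ₂≢τ (proj₂ (⊗-reflects-diagonal d₁ d₂ below₁ below₂ ⊗≡)))

    row : Carrier × List ℕ → PS → PS
    row s w = map (λ t → (proj₁ s *K proj₁ t , proj₂ s ⊗ proj₂ t)) w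

    coeff-row : ∀ {ρ₁} a w → IsDiagram k ρ₁ → ρ₁ ⊴ σ → Triangular l τ w →
      coeff (row (a , ρ₁) w) (σ ⊗ τ) ≈ when (ρ₁ ≟L σ) a *K coeff w τ
    coeff-row a [] d₁ below₁ [] = sym (zeroʳ _)
    coeff-row {ρ₁} a ((b , ρ₂) ∷ w) d₁ below₁ ((d₂ , below₂) ∷ tw) = begin
      coeff ((a *K b , ρ₁ ⊗ ρ₂) ∷ row (a , ρ₁) w) (σ ⊗ τ)
        ≈⟨ coeff-∷ (a *K b) (ρ₁ ⊗ ρ₂) (row (a , ρ₁) w) (σ ⊗ τ) ⟩
      when ((ρ₁ ⊗ ρ₂) ≟L (σ ⊗ τ)) (a *K b) +K coeff (row (a , ρ₁) w) (σ ⊗ τ)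
        ≈⟨ +-cong (when-⊗ d₁ d₂ below₁ below₂ a b) (coeff-row a w d₁ below₁ tw) ⟩
      when (ρ₁ ≟L σ) a *K when (ρ₂ ≟L τ) b +K when (ρ₁ ≟L σ) a *K coeff w τ
        ≈⟨ sym (distribˡ _ _ _) ⟩
      when (ρ₁ ≟L σ) a *K (when (ρ₂ ≟L τ) b +K coeff w τ)
        ≈⟨ *-congˡ (sym (coeff-∷ b ρ₂ w τ)) ⟩
      when (ρ₁ ≟L σ) a *K coeff ((b , ρ₂) ∷ w) τ ∎

    coeff-*P : ∀ v w → Triangular k σ v → Triangular l τ w → coeff (v *P w) (σ ⊗ τ) ≈ coeff v σ *K coeff w τ
    coeff-*P [] w [] tw = sym (zeroˡ _)
    coeff-*P ((a , ρ₁) ∷ v) w ((d₁ , below₁) ∷ tv) tw = begin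
      coeff (row (a , ρ₁) w ++ v *P w) (σ ⊗ τ)
        ≈⟨ coeff-++ (row (a , ρ₁) w) (v *P w) (σ ⊗ τ) ⟩
      coeff (row (a , ρ₁) w) (σ ⊗ τ) +K coeff (v *P w) (σ ⊗ τ)
        ≈⟨ +-cong (coeff-row a w d₁ below₁ tw) (coeff-*P v w tv tw) ⟩
      when (ρ₁ ≟L σ) a *K coeff w τ +K coeff v σ *K coeff w τ
        ≈⟨ sym (distribʳ _ _ _) ⟩
      (when (ρ₁ ≟L σ) a +K coeff v σ) *K coeff w τ
        ≈⟨ *-congʳ (sym (coeff-∷ a ρ₁ v σ)) ⟩
      coeff ((a , ρ₁) ∷ v) σ *K coeff w τ ∎

    *P-triangular : ∀ {v w} → Triangular k σ v → Triangular l τ w → Triangular (k + l) (σ ⊗ τ) (v *P w)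
    *P-triangular tv tw = All.concat⁺ (All.map⁺ (All.map (λ (d₁ , below₁) → All.map⁺ (All.map (λ (d₂ , below₂) →
      ⊗-IsDiagram {k} {l} d₁ d₂ , diagonal-or-below (⊗-⊴ {k} {l} d₁ dσ d₂ dτ below₁ below₂)) tw)) tv))
      where
      diagonal-or-below : ∀ {ρ₁ ρ₂} → (ρ₁ ≡ σ × ρ₂ ≡ τ) ⊎ _ → (ρ₁ ⊗ ρ₂) ⊴ (σ ⊗ τ)
      diagonal-or-below (inj₁ (ρ₁≡σ , ρ₂≡τ)) = inj₁ (≡.cong₂ _⊗_ ρ₁≡σ ρ₂≡τ)
      diagonal-or-below (inj₂ fewer) = inj₂ fewer

  open BulletProducts

  prodH-single : ∀ ρs → ∃ λ a → prodH ρs ≡ [ (a , fold⊗ ρs) ]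
  prodH-single [] = 1# , ≡.refl
  prodH-single (ρ ∷ ρs) with prodH-single ρs
  ... | a , eq rewrite eq = 1# *K a , ≡.refl

  EirrSummand : ℕ → List ℕ → List (List ℕ) → PS
  EirrSummand n τ ρs = if bulletFold ρs =L τ then scale (sign (length ρs + n)) (prodH ρs) else []

  Eirr-by-tuples : ∀ {m τ} → IsDiagram (suc m) τ → Eirr τ ≡ concatMap (EirrSummand (suc m) τ) (tuples (suc m))
  Eirr-by-tuples {m} dτ rewrite ord-IsDiagram {suc m} dτ = ≡.refl

  module _ {m τ} (dτ : IsDiagram (suc m) τ) where

    EirrSummand-triangular : ∀ {ρs} → ρs ∈ tuples (suc m) → Triangular (suc m) τ (EirrSummand (suc m) τ ρs)
    EirrSummand-triangular {ρs} ρs∈ with bulletFold ρs =L τ in bullet≡τ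
    ... | false = []
    ... | true with prodH-single ρs | fold⊗-below-bulletFold {m} ρs∈ (=L⇒≡ bullet≡τ)
    ...   | a , eq | dfold , shape rewrite eq = (dfold , ⊴-shape shape) ∷ []
      where
      ⊴-shape : ρs ≡ [ τ ] ⊎ _ → fold⊗ ρs ⊴ τ
      ⊴-shape (inj₁ ≡.refl) = inj₁ (⊗-identityʳ {suc m} dτ)
      ⊴-shape (inj₂ fewer) = inj₂ fewer

    Eirr-triangular : Triangular (suc m) τ (Eirr τ)
    Eirr-triangular rewrite Eirr-by-tuples dτ = All.concat⁺ (All.map⁺ (All.tabulate EirrSummand-triangular))

    EirrSummand-off-diagonal : ∀ {ρs} → ρs ∈ tuples (suc m) → ρs ≢ [ τ ] → coeff (EirrSummand (suc m) τ ρs) τ ≈ 0#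
    EirrSummand-off-diagonal {ρs} ρs∈ ρs≢ with bulletFold ρs =L τ in bullet≡τ
    ... | false = refl
    ... | true with prodH-single ρs | fold⊗-below-bulletFold {m} ρs∈ (=L⇒≡ bullet≡τ)
    ...   | a , eq | _ , inj₁ ρs≡ = ⊥-elim (ρs≢ ρs≡)
    ...   | a , eq | _ , inj₂ fewer rewrite eq = coeff-absent _ τ (fewer-coincidences⇒≢ fewer ∷ [])

    EirrSummand-diagonal : coeff (EirrSummand (suc m) τ [ τ ]) τ ≈ sign (suc (suc m)) *K (1# *K 1#)
    EirrSummand-diagonal rewrite =L-refl τ = begin
      coeff [ (sign (suc (suc m)) *K (1# *K 1#) , τ ⊗ []) ] τ
        ≈⟨ coeff-∷ _ (τ ⊗ []) [] τ ⟩
      when ((τ ⊗ []) ≟L τ) (sign (suc (suc m)) *K (1# *K 1#)) +K 0#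
        ≈⟨ +-identityʳ _ ⟩
      when ((τ ⊗ []) ≟L τ) (sign (suc (suc m)) *K (1# *K 1#))
        ≈⟨ when-yes ((τ ⊗ []) ≟L τ) _ (⊗-identityʳ {suc m} dτ) ⟩
      sign (suc (suc m)) *K (1# *K 1#) ∎

    Eirr-diagonal : Invertible (coeff (Eirr τ) τ)
    Eirr-diagonal rewrite Eirr-by-tuples dτ = invertible-cong (sym diagonal)
      (invertible-* (invertible-sign (suc (suc m))) (invertible-cong (sym (*-identityˡ 1#)) invertible-1))
      where
      diagonal : coeff (concatMap (EirrSummand (suc m) τ) (tuples (suc m))) τ ≈ sign (suc (suc m)) *K (1# *K 1#)
      diagonal = begin
        coeff (concatMap (EirrSummand (suc m) τ) (tuples (suc m))) τ
          ≈⟨ coeff-concatMap _ (tuples (suc m)) τ ⟩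
        ∑ (tuples (suc m)) (λ ρs → coeff (EirrSummand (suc m) τ ρs) τ)
          ≈⟨ Tuples.∑-concentrated-once +-commutativeMonoid (tuples (suc m)) [ τ ] (tuples-single {m} dτ) EirrSummand-off-diagonal ⟩
        coeff (EirrSummand (suc m) τ [ τ ]) τ
          ≈⟨ EirrSummand-diagonal ⟩
        sign (suc (suc m)) *K (1# *K 1#) ∎

  Eprod : List (List ℕ) → PS
  Eprod τs = foldr (λ τ acc → Eirr τ *P acc) (H []) τs

  Eprod-unitriangular : ∀ {c τs} → Pointwise IsDiagram c τs → All (0 <_) c →
    Triangular (sum c) (fold⊗ τs) (Eprod τs) × Invertible (coeff (Eprod τs) (fold⊗ τs))
  Eprod-unitriangular [] [] =
    ((≡.refl , ≡.refl) , inj₁ ≡.refl) ∷ [] ,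
    invertible-cong (sym (trans (coeff-H [] []) (when-yes ([] ≟L []) 1# ≡.refl))) invertible-1
  Eprod-unitriangular {suc a ∷ c} {τ ∷ τs} (dτ ∷ dτs) (z<s ∷ pos) with Eprod-unitriangular dτs pos
  ... | triangular , invertible =
    *P-triangular {suc a} {sum c} dτ dfold (Eirr-triangular {a} dτ) triangular ,
    invertible-cong (sym (coeff-*P {suc a} {sum c} dτ dfold (Eirr τ) (Eprod τs) (Eirr-triangular {a} dτ) triangular))
                    (invertible-* (Eirr-diagonal {a} dτ) invertible)
    where
    dfold : IsDiagram (sum c) (fold⊗ τs)
    dfold = fold⊗-IsDiagram dτs

  E-unitriangular : ∀ {n π} → IsDiagram n π → Triangular n π (E π) × Invertible (coeff (E π) π)
  E-unitriangular {n} {π} dπ with factors-sound {n} dπ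
  ... | c , (pos , total) , dτs , fold≡π =
    ≡.subst₂ (λ n σ → Triangular n σ (E π) × Invertible (coeff (E π) σ)) total fold≡π (Eprod-unitriangular dτs pos)

  E-triangular : ∀ {n π} → IsDiagram n π → Triangular n π (E π)
  E-triangular {n} dπ = proj₁ (E-unitriangular {n} dπ)

  E-unit-diagonal : ∀ {n π} → IsDiagram n π → Invertible (coeff (E π) π)
  E-unit-diagonal {n} dπ = proj₂ (E-unitriangular {n} dπ)

module UnitriangularBasis {c ℓ} (K : Field c ℓ)
  (Adm : List ℕ → Set) (Adm? : Decidable Adm)
  (D : List (List ℕ)) (D-sound : ∀ {σ} → σ ∈ D → Adm σ) (D-complete : ∀ {σ} → Adm σ → Counting.Words.count σ D ≡ 1)
  (F : List ℕ → ParSym.PS K)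
  (F-triangular : ∀ {σ} → Adm σ → All (λ t → Adm (proj₂ t) × DiagramOperations._⊴_ (proj₂ t) σ) (F σ))
  (F-unit-diagonal : ∀ {σ} → Adm σ → Coefficients.Invertible K (ParSym.coeff K (F σ) σ)) where
  open ParSym K
  open Coefficients K
  open DiagramOperations using (_⊴_)
  open Counting using (_≟L_; module Words)
  open import Level using () renaming (_⊔_ to _⊔ˡ_)
  open import Data.Nat using (_<_; _≤_; _∸_; _⊔_; _<?_)
  import Data.Nat.Properties as ℕ
  open import Data.Nat.Induction using (<-wellFounded)
  open import Data.List using ([]; _∷_; _++_; foldr)
  open import Data.List.Relation.Unary.Any using (here; there)
  open import Data.List.Relation.Unary.All as All using ([]; _∷_)
  import Data.List.Relation.Unary.All.Properties as All
  open import Data.Product using (∃)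
  open import Data.Sum using (inj₁; inj₂)
  open import Relation.Nullary using (¬_; Dec; yes; no)
  open import Induction.WellFounded using (WellFounded)
  import Induction.WellFounded as WF
  import Relation.Binary.Construct.On as On
  import Relation.Binary.PropositionalEquality as ≡
  open ≡ using (_≢_)

  open Field K renaming (_+_ to _+K_; _*_ to _*K_)
  open Coincidences using (coincidences)
  open ListSum +-commutativeMonoid using (∑; ∑-vanishing)
  open import Relation.Binary.Reasoning.Setoid setoid

  Admissible : PS → Set c
  Admissible v = All (λ t → Adm (proj₂ t)) v

  coeff-inadmissible : ∀ {v ρ} → Admissible v → ¬ Adm ρ → coeff v ρ ≈ 0#
  coeff-inadmissible {v} {ρ} adm ¬adm = coeff-absent v ρ (All.map (λ a label≡ρ → ¬adm (≡.subst Adm label≡ρ a)) adm)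

  F-supported : ∀ {σ} → Adm σ → ∀ ρ → ¬ Adm ρ → coeff (F σ) ρ ≈ 0#
  F-supported aσ ρ = coeff-inadmissible (All.map proj₁ (F-triangular aσ))

  F-off-diagonal : ∀ {σ ρ} → Adm σ → ρ ≢ σ → ¬ (coincidences ρ < coincidences σ) → coeff (F σ) ρ ≈ 0#
  F-off-diagonal {σ} {ρ} aσ ρ≢σ ¬fewer = coeff-absent (F σ) ρ (All.map (λ {t} → not-ρ {t}) (F-triangular aσ))
    where
    not-ρ : ∀ {t : Carrier × List ℕ} → Adm (proj₂ t) × proj₂ t ⊴ σ → proj₂ t ≢ ρ
    not-ρ (_ , inj₁ label≡σ) label≡ρ = ρ≢σ (≡.trans (≡.sym label≡ρ) label≡σ)
    not-ρ (_ , inj₂ fewer) ≡.refl = ¬fewer fewer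

  Adm⇒∈ : ∀ {σ} → Adm σ → σ ∈ D
  Adm⇒∈ aσ = Words.count≡suc⇒∈ D (D-complete aσ)

  maxCoincidences : ℕ
  maxCoincidences = foldr (λ ρ m → coincidences ρ ⊔ m) 0 D

  coincidences-≤-max : ∀ {ρ} → Adm ρ → coincidences ρ ≤ maxCoincidences
  coincidences-≤-max aρ = bounded D (Adm⇒∈ aρ)
    where
    bounded : ∀ xs {ρ} → ρ ∈ xs → coincidences ρ ≤ foldr (λ ρ m → coincidences ρ ⊔ m) 0 xs
    bounded (x ∷ xs) (here ≡.refl) = ℕ.m≤m⊔n (coincidences x) _
    bounded (x ∷ xs) (there ρ∈) = ℕ.≤-trans (bounded xs ρ∈) (ℕ.m≤n⊔m (coincidences x) _)

  module _ (cs : PS) (adm : Admissible cs) (vanishes : combination F cs ≈P 0P) where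

    coeff-vanishes-from-above : ∀ {π} → Adm π → (∀ {ρ} → Adm ρ → coincidences π < coincidences ρ → coeff cs ρ ≈ 0#) →
      coeff cs π ≈ 0#
    coeff-vanishes-from-above {π} aπ above = invertible-cancel (coeff cs π) (F-unit-diagonal aπ) (begin
      coeff cs π *K coeff (F π) π
        ≈⟨ sym (Words.∑-concentrated-once +-commutativeMonoid D π (D-complete aπ) off-π) ⟩
      ∑ D (λ ρ → coeff cs ρ *K coeff (F ρ) π)
        ≈⟨ sym (∑-regroup D (λ ρ → coeff (F ρ) π) cs (All.map D-complete adm)) ⟩
      ∑ cs (λ t → proj₁ t *K coeff (F (proj₂ t)) π)
        ≈⟨ sym (coeff-combination F cs π) ⟩
      coeff (combination F cs) π
        ≈⟨ vanishes π ⟩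
      0# ∎)
      where
      off-π : ∀ {ρ} → ρ ∈ D → ρ ≢ π → coeff cs ρ *K coeff (F ρ) π ≈ 0#
      off-π {ρ} ρ∈ ρ≢π with coincidences π <? coincidences ρ
      ... | yes more = trans (*-congʳ (above (D-sound ρ∈) more)) (zeroˡ _)
      ... | no ¬more = trans (*-congˡ (F-off-diagonal (D-sound ρ∈) (λ π≡ρ → ρ≢π (≡.sym π≡ρ)) ¬more)) (zeroʳ _)

    independent : ∀ π → coeff cs π ≈ 0#
    independent π with Adm? π
    ... | no ¬aπ = coeff-inadmissible adm ¬aπ
    ... | yes aπ = WF.All.wfRec room-wellFounded _ (λ π → Adm π → coeff cs π ≈ 0#) step π aπ
      where
      room : List ℕ → ℕ
      room ρ = maxCoincidences ∸ coincidences ρ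
      room-wellFounded : WellFounded (λ ρ π → room ρ < room π)
      room-wellFounded = On.wellFounded room <-wellFounded
      step : ∀ π → (∀ {ρ} → room ρ < room π → Adm ρ → coeff cs ρ ≈ 0#) → Adm π → coeff cs π ≈ 0#
      step π ih aπ = coeff-vanishes-from-above aπ (λ aρ more → ih (ℕ.∸-monoʳ-< more (coincidences-≤-max aρ)) aρ)

  Spanned : List ℕ → Set (c ⊔ˡ ℓ)
  Spanned σ = ∃ λ cs → Admissible cs × combination F cs ≈P H σ

  scale-admissible : ∀ a {cs} → Admissible cs → Admissible (scale a cs)
  scale-admissible a adm = All.map⁺ adm

  coeff-H-≢ : ∀ {ρ x} → ρ ≢ x → coeff (H ρ) x ≈ 0#
  coeff-H-≢ {ρ} {x} ρ≢x = trans (coeff-H ρ x) (when-no (ρ ≟L x) 1# ρ≢x)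

  module _ {σ} (aσ : Adm σ) (ih : ∀ {ρ} → coincidences ρ < coincidences σ → Adm ρ → Spanned ρ) where
    private
      u = coeff (F σ) σ
      u⁻¹ = proj₁ (F-unit-diagonal aσ)

      -- H σ = u⁻¹ (F σ + Σ_ρ correction ρ · H ρ), and every H ρ with correction ρ ≠ 0 lies lower.
      correction : List ℕ → Carrier
      correction ρ = when (coincidences ρ <? coincidences σ) (- coeff (F σ) ρ)

      corrections : ∀ xs → All Adm xs → ∃ λ r → Admissible r ×
        ∀ x → coeff (combination F r) x ≈ ∑ xs (λ ρ → correction ρ *K coeff (H ρ) x)
      corrections [] [] = [] , [] , λ _ → refl
      corrections (ρ ∷ xs) (aρ ∷ axs) = extend (coincidences ρ <? coincidences σ)
        where
        r = proj₁ (corrections xs axs)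
        ar = proj₁ (proj₂ (corrections xs axs))
        er = proj₂ (proj₂ (corrections xs axs))
        extend : Dec (coincidences ρ < coincidences σ) → ∃ λ r → Admissible r ×
          ∀ x → coeff (combination F r) x ≈ ∑ (ρ ∷ xs) (λ ρ → correction ρ *K coeff (H ρ) x)
        extend (no ¬fewer) = r , ar , λ x → trans (er x) (sym (trans (+-congʳ (trans
          (*-congʳ (when-no (coincidences ρ <? coincidences σ) _ ¬fewer)) (zeroˡ _))) (+-identityˡ _)))
        extend (yes fewer) with ih fewer aρ
        ... | cρ , acρ , ecρ = scale a cρ ++ r , All.++⁺ (scale-admissible a acρ) ar , λ x → begin
          coeff (combination F (scale a cρ ++ r)) x
            ≈⟨ coeff-combination-++ F (scale a cρ) r x ⟩
          coeff (combination F (scale a cρ)) x +K coeff (combination F r) x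
            ≈⟨ +-cong (coeff-combination-scale F a cρ x) (er x) ⟩
          a *K coeff (combination F cρ) x +K ∑ xs _
            ≈⟨ +-congʳ (*-congˡ (ecρ x)) ⟩
          a *K coeff (H ρ) x +K ∑ xs _
            ≈⟨ +-congʳ (*-congʳ (sym (when-yes (coincidences ρ <? coincidences σ) a fewer))) ⟩
          correction ρ *K coeff (H ρ) x +K ∑ xs (λ ρ → correction ρ *K coeff (H ρ) x) ∎
          where a = - coeff (F σ) ρ

      correction-sum : ∀ x → ∑ D (λ ρ → correction ρ *K coeff (H ρ) x) ≈ when (Adm? x) (correction x)
      correction-sum x with Adm? x
      ... | no ¬ax =
        ∑-vanishing D (λ ρ∈ → trans (*-congˡ (coeff-H-≢ (λ ρ≡x → ¬ax (≡.subst Adm ρ≡x (D-sound ρ∈))))) (zeroʳ _))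
      ... | yes ax = trans (Words.∑-concentrated-once +-commutativeMonoid D x (D-complete ax)
                              (λ _ ρ≢x → trans (*-congˡ (coeff-H-≢ ρ≢x)) (zeroʳ _)))
                           (trans (*-congˡ (trans (coeff-H x x) (when-yes (x ≟L x) 1# ≡.refl))) (*-identityʳ _))

      F-expansion : ∀ x → coeff (F σ) x +K when (Adm? x) (correction x) ≈ u *K coeff (H σ) x
      F-expansion x with Adm? x | x ≟L σ
      ... | no ¬ax | _ = trans (+-identityʳ _) (trans (F-supported aσ x ¬ax)
                           (sym (trans (*-congˡ (coeff-H-≢ (λ σ≡x → ¬ax (≡.subst Adm σ≡x aσ)))) (zeroʳ u))))
      ... | yes _ | yes ≡.refl = begin
        u +K correction σ     ≈⟨ +-congˡ (when-no (coincidences σ <? coincidences σ) _ (ℕ.<-irrefl ≡.refl)) ⟩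
        u +K 0#               ≈⟨ +-identityʳ u ⟩
        u                     ≈⟨ sym (*-identityʳ u) ⟩
        u *K 1#               ≈⟨ *-congˡ (sym (trans (coeff-H σ σ) (when-yes (σ ≟L σ) 1# ≡.refl))) ⟩
        u *K coeff (H σ) σ    ∎
      ... | yes _ | no x≢σ = trans (off-diagonal (coincidences x <? coincidences σ))
                                   (sym (trans (*-congˡ (coeff-H-≢ (λ σ≡x → x≢σ (≡.sym σ≡x)))) (zeroʳ u)))
        where
        off-diagonal : Dec (coincidences x < coincidences σ) → coeff (F σ) x +K correction x ≈ 0#
        off-diagonal (yes fewer) = trans (+-congˡ (when-yes (coincidences x <? coincidences σ) _ fewer)) (-‿inverseʳ _)
        off-diagonal (no ¬fewer) = trans (+-cong (F-off-diagonal aσ x≢σ ¬fewer)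
                                                 (when-no (coincidences x <? coincidences σ) _ ¬fewer)) (+-identityʳ 0#)

    H-spanned-step : Spanned σ
    H-spanned-step with corrections D (All.tabulate D-sound)
    ... | r , ar , er = scale u⁻¹ ((1# , σ) ∷ r) , scale-admissible u⁻¹ (aσ ∷ ar) , λ x → begin
      coeff (combination F (scale u⁻¹ ((1# , σ) ∷ r))) x
        ≈⟨ coeff-combination-scale F u⁻¹ ((1# , σ) ∷ r) x ⟩
      u⁻¹ *K coeff (scale 1# (F σ) ++ combination F r) x
        ≈⟨ *-congˡ (coeff-++ (scale 1# (F σ)) (combination F r) x) ⟩
      u⁻¹ *K (coeff (scale 1# (F σ)) x +K coeff (combination F r) x)
        ≈⟨ *-congˡ (+-cong (trans (coeff-scale 1# (F σ) x) (*-identityˡ _)) (trans (er x) (correction-sum x))) ⟩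
      u⁻¹ *K (coeff (F σ) x +K when (Adm? x) (correction x))
        ≈⟨ *-congˡ (F-expansion x) ⟩
      u⁻¹ *K (u *K coeff (H σ) x)
        ≈⟨ sym (*-assoc u⁻¹ u _) ⟩
      (u⁻¹ *K u) *K coeff (H σ) x
        ≈⟨ *-congʳ (trans (*-comm u⁻¹ u) (proj₂ (F-unit-diagonal aσ))) ⟩
      1# *K coeff (H σ) x
        ≈⟨ *-identityˡ _ ⟩
      coeff (H σ) x ∎

  H-spanned : ∀ {σ} → Adm σ → Spanned σ
  H-spanned {σ} = WF.All.wfRec fewer-wellFounded _ (λ σ → Adm σ → Spanned σ)
                                (λ σ ih aσ → H-spanned-step aσ (λ fewer → ih fewer)) σ
    where
    fewer-wellFounded : WellFounded (λ ρ σ → coincidences ρ < coincidences σ)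
    fewer-wellFounded = On.wellFounded coincidences <-wellFounded

  Spans : PS → Set (c ⊔ˡ ℓ)
  Spans v = ∃ λ cs → Admissible cs × combination F cs ≈P v

  spans-∷ : ∀ a {σ v} → Spanned σ → Spans v → Spans ((a , σ) ∷ v)
  spans-∷ a {σ} {v} (cσ , acσ , ecσ) (cs , acs , ecs) = scale a cσ ++ cs , All.++⁺ (scale-admissible a acσ) acs , λ x → begin
    coeff (combination F (scale a cσ ++ cs)) x
      ≈⟨ coeff-combination-++ F (scale a cσ) cs x ⟩
    coeff (combination F (scale a cσ)) x +K coeff (combination F cs) x
      ≈⟨ +-cong (coeff-combination-scale F a cσ x) (ecs x) ⟩
    a *K coeff (combination F cσ) x +K coeff v x
      ≈⟨ +-congʳ (*-congˡ (trans (ecσ x) (coeff-H σ x))) ⟩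
    a *K when (σ ≟L x) 1# +K coeff v x
      ≈⟨ +-congʳ (trans (sym (when-* (σ ≟L x) a 1#)) (when-cong (σ ≟L x) (*-identityʳ a))) ⟩
    when (σ ≟L x) a +K coeff v x
      ≈⟨ sym (coeff-∷ a σ v x) ⟩
    coeff ((a , σ) ∷ v) x ∎

  spans : ∀ v → Admissible v → Spans v
  spans [] [] = [] , [] , λ _ → refl
  spans ((a , σ) ∷ v) (aσ ∷ av) = spans-∷ a {σ} {v} (H-spanned aσ) (spans v av)

theorem3p14 : ∀ {c ℓ} (K : Field c ℓ) (n : ℕ) → ParSym.IsBasisE K n
theorem3p14 K n = (λ _ dπ → F-supported dπ) , spans , independent
  where
  open Enumeration using (IsDiagram?; diagrams-sound; diagrams-complete)
  open Triangularity K using (E-triangular; E-unit-diagonal)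
  open UnitriangularBasis K (IsDiagram n) (IsDiagram? n) (diagrams n) (diagrams-sound n) (diagrams-complete {n})
         (ParSym.E K) (E-triangular {n}) (E-unit-diagonal {n})
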